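{- Let $F(n)=\prod_{j=1}^k(a_jn+b_j)$ with integers $a_j\ne0$, $b_j$, non-zero discriminant, and $\gamma(q)>0$ for all $q\ge1$. Let $R\ge1$ be an integer. Then for all integers $n$, \[ \alpha_R(n)=G(R)\sum_{\substack{d\le R\\ d\mid F(n)}}\lambda_d. \]
   Context: $e_q(x)=e^{2\pi ix/q}$, $\mathbb{Z}_q^*=\{a\in\mathbb{Z}/q\mathbb{Z}:\gcd(a,q)=1\}$, $\mu$ is the Möbius function. $X_q:=\{n\in\mathbb{Z}/q\mathbb{Z}:\gcd(q,F(n))=1\}$, $\gamma(q):=|X_q|/q$. $s(a/q):=\frac1{|X_q|}\sum_{m\in X_q}e_q(am)$ (depends only on the rational $a/q$). $\alpha_R(n):=\sum_{q\le R}\sum_{a\in\mathbb{Z}_q^*}s(a/q)e_q(-an)$. $h(q):=\mu(q)^2\prod_{p\mid q}\frac{1-\gamma(p)}{\gamma(p)}$, $G(R):=\sum_{q\le R}h(q)$, $G_d(x):=\sum_{q\le x,\ \gcd(q,d)=1}h(q)$, and $\lambda_d:=\frac{\mu(d)G_d(R/d)}{\gamma(d)G(R)}$. -}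

module Defs where

open import Level using (0ℓ)
open import Algebra.Bundles using (CommutativeRing)
open import Data.Nat as ℕ using (ℕ; zero; suc; _<_; _≤_; NonZero)
open import Data.Nat.Divisibility using (_∣_; _∣?_)
open import Data.Nat.DivMod using (_/_)
open import Data.Nat.GCD using (gcd)
open import Data.Nat.Primality using (prime?)
open import Data.Integer as ℤ using (ℤ; +_; -[1+_]; ∣_∣)
open import Data.Integer.DivMod using (_%ℕ_)
open import Data.List using (List; []; _∷_; foldr; map; filter; upTo; length)
open import Data.Product using (_×_; _,_; proj₁; proj₂)
open import Relation.Nullary using (¬_; Dec; yes; no)
open import Relation.Nullary.Decidable using (_×-dec_; ⌊_⌋)
open import Relation.Binary.PropositionalEquality using (_≡_)
open import Data.Bool using (if_then_else_)

-- The polynomial F(n) = ∏_{j} (a_j n + b_j), given by its list of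
-- coefficient pairs (a_j , b_j); k = length of the list.

LinFactors : Set
LinFactors = List (ℤ × ℤ)

evalF : LinFactors → ℤ → ℤ
evalF F n = foldr (λ ab acc → (proj₁ ab ℤ.* n ℤ.+ proj₂ ab) ℤ.* acc) (+ 1) F

prodℤ : List ℤ → ℤ
prodℤ = foldr ℤ._*_ (+ 1)

-- Discriminant of F = ∏_j (a_j x + b_j) (degree k, leading coeff A = ∏ a_j,
-- roots r_j = -b_j/a_j):  disc F = A^{2k-2} ∏_{i<j} (r_i - r_j)^2
--                                 = ∏_j a_j^{2k-2} · ∏_{i<j} (a_i b_j - a_j b_i)^2 .
pairTerms : ℤ × ℤ → LinFactors → List ℤ
pairTerms (a , b) F = map (λ cd → let t = a ℤ.* proj₂ cd ℤ.- proj₁ cd ℤ.* b in t ℤ.* t) F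

crossProd : LinFactors → ℤ
crossProd [] = + 1
crossProd (ab ∷ F) = prodℤ (pairTerms ab F) ℤ.* crossProd F

powℤ : ℤ → ℕ → ℤ
powℤ x zero = + 1
powℤ x (suc n) = x ℤ.* powℤ x n

disc : LinFactors → ℤ
disc F = prodℤ (map (λ ab → powℤ (proj₁ ab) (2 ℕ.* length F ℕ.∸ 2)) F) ℤ.* crossProd F

-- X_q = { n ∈ ℤ/qℤ : gcd(q, F(n)) = 1 }, represented by residues 0 ≤ n < q.

Xlist : LinFactors → ℕ → List ℕ
Xlist F q = filter (λ m → gcd q ∣ evalF F (+ m) ∣ ℕ.≟ 1) (upTo q)

cardX : LinFactors → ℕ → ℕ
cardX F q = length (Xlist F q)

units : ℕ → List ℕ
units q = filter (λ a → gcd a q ℕ.≟ 1) (upTo q)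

primeDivisors : ℕ → List ℕ
primeDivisors q = filter (λ p → prime? p ×-dec (p ∣? q)) (upTo (suc q))

squarefree? : ℕ → Data.Bool.Bool
squarefree? q = ⌊ length (filter (λ d → (2 ℕ.≤? d) ×-dec ((d ℕ.* d) ∣? q)) (upTo (suc q))) ℕ.≟ 0 ⌋

μ : ℕ → ℤ
μ q = if squarefree? q then powℤ -[1+ 0 ] (length (primeDivisors q)) else + 0

-- A field of characteristic 0 containing a primitive N-th root of unity ζ.
-- With K = ℂ and ζ = e^{2πi/N}, e_q(x) = e^{2πix/q} = ζ^{(N/q)(x mod q)}
-- whenever q ∣ N.

module RingOps (K : CommutativeRing 0ℓ 0ℓ) where
  open CommutativeRing K
  fromℕ : ℕ → Carrier
  fromℕ zero = 0#
  fromℕ (suc n) = 1# + fromℕ n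
  fromℤ : ℤ → Carrier
  fromℤ (+ n) = fromℕ n
  fromℤ -[1+ n ] = - fromℕ (suc n)
  pow : Carrier → ℕ → Carrier
  pow x zero = 1#
  pow x (suc n) = x * pow x n

record CycloField (N : ℕ) : Set₁ where
  field
    K : CommutativeRing 0ℓ 0ℓ
  open CommutativeRing K public
  open RingOps K public
  field
    _⁻¹ : Carrier → Carrier
    inverse : ∀ x → ¬ (x ≈ 0#) → x * (x ⁻¹) ≈ 1#
    charZero : ∀ n → ¬ (fromℕ (suc n) ≈ 0#)
    ζ : Carrier
    ζ-root : pow ζ N ≈ 1#
    ζ-primitive : ∀ d → 0 < d → d < N → ¬ (pow ζ d ≈ 1#)

module WithField {N : ℕ} (C : CycloField N) where
  open CycloField C

  sumK : List Carrier → Carrier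
  sumK = foldr _+_ 0#

  prodK : List Carrier → Carrier
  prodK = foldr _*_ 1#

  e : (q : ℕ) → .{{NonZero q}} → ℤ → Carrier
  e q x = pow ζ ((N / q) ℕ.* (x %ℕ q))

  γ : LinFactors → (q : ℕ) → Carrier
  γ F q = fromℕ (cardX F q) * (fromℕ q ⁻¹)

  s : LinFactors → ℕ → (q : ℕ) → .{{NonZero q}} → Carrier
  s F a q = (fromℕ (cardX F q) ⁻¹) * sumK (map (λ m → e q (+ (a ℕ.* m))) (Xlist F q))

  -- α_R(n) = Σ_{q ≤ R} Σ_{a ∈ ℤ_q^*} s(a/q) e_q(-a n)   (q ranges over 1..R)
  α : LinFactors → ℕ → ℤ → Carrier
  α F R n = sumK (map (λ i → sumK (map (λ a → s F a (suc i) * e (suc i) (ℤ.- (+ a ℤ.* n))) (units (suc i)))) (upTo R))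

  h : LinFactors → ℕ → Carrier
  h F q = (fromℤ (μ q) * fromℤ (μ q)) * prodK (map (λ p → (1# - γ F p) * (γ F p ⁻¹)) (primeDivisors q))

  Gd : LinFactors → ℕ → ℕ → Carrier
  Gd F d x = sumK (map (λ i → h F (suc i)) (filter (λ i → gcd (suc i) d ℕ.≟ 1) (upTo x)))

  G : LinFactors → ℕ → Carrier
  G F R = sumK (map (λ i → h F (suc i)) (upTo R))

  λ' : LinFactors → ℕ → (d : ℕ) → .{{NonZero d}} → Carrier
  λ' F R d = (fromℤ (μ d) * Gd F d (R / d)) * ((γ F d * G F R) ⁻¹)

  -- G(R) Σ_{d ≤ R, d ∣ F(n)} λ_d     (d ranges over 1..R)
  rhs : LinFactors → ℕ → ℤ → Carrier
  rhs F R n = G F R * sumK (map (λ i → λ' F R (suc i)) (filter (λ i → suc i ∣? ∣ evalF F n ∣) (upTo R)))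

{-# OPTIONS --safe #-}
module Submission where

-- Write α_R(n) = ∑_{q ≤ R} c(q), where c(q) = ∑_{a ∈ ℤ_q^*} s(a/q) e_q(-an)
-- = |X_q|⁻¹ ∑_{a ∈ ℤ_q^*} ∑_{m ∈ X_q} e_q(a(m - n)).  By the Chinese remainder theorem c is
-- multiplicative; c(q) = 0 when p² ∣ q, since m ↦ m + q/p permutes X_q and multiplies the
-- inner sum by e_p(a) ≠ 1; and for a prime p the sum over a is a Ramanujan sum, which gives
-- c(p) = h(p) - [p ∣ F(n)]/γ(p).  On the other side, expanding λ_d = μ(d)G_d(R/d)/(γ(d)G(R))
-- and exchanging the sums over d and q/d turns G(R) ∑_{d ≤ R, d ∣ F(n)} λ_d into ∑_{q ≤ R} r(q),
-- r(q) = ∑_{d ∣ q, d ∣ F(n), (d, q/d) = 1} μ(d) h(q/d)/γ(d); r is multiplicative, vanishes when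
-- p² ∣ q and has the same values at primes, so c = r.  Dividing by G(R) is legitimate because
-- h ≥ 0 (as γ(p) ≤ 1) and h(1) = 1.

open import Defs
open import Level using (0ℓ)
open import Algebra.Bundles using (CommutativeRing; RawRing)
import Algebra.Solver.Ring as RingSolver
open import Algebra.Solver.Ring.AlmostCommutativeRing using (fromCommutativeRing; _-Raw-AlmostCommutative⟶_)
open import Data.Bool using (true; false)
open import Data.Empty using (⊥-elim)
open import Data.Integer as ℤ using (ℤ; +_; -[1+_]; ∣_∣)
import Data.Integer.Properties as ℤP
import Data.Integer.Divisibility.Signed as ℤD
open import Data.Integer.DivMod using (_%ℕ_; _/ℕ_; a≡a%ℕn+[a/ℕn]*n; n%ℕd<d)
open import Data.Integer.Solver using (module +-*-Solver)
open import Data.List using (List; []; _∷_; _++_; map; filter; upTo; length; foldr; cartesianProduct)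
import Data.List.Properties as List
open import Data.List.Membership.Propositional using (_∈_; lose)
open import Data.List.Membership.Propositional.Properties
  using (∈-∃++; ∈-map⁺; ∈-map⁻; ∈-upTo⁺; ∈-upTo⁻; ∈-filter⁺; ∈-filter⁻; ∈-++⁺ˡ; ∈-++⁺ʳ; ∈-++⁻; ∈-cartesianProduct⁺; ∈-cartesianProduct⁻)
open import Data.List.Membership.Propositional.Properties.WithK using (unique∧set⇒bag)
open import Data.List.Relation.Binary.BagAndSetEquality using (∼bag⇒↭)
open import Data.List.Relation.Binary.Permutation.Propositional using (_↭_; ↭-refl; ↭-trans; ↭-sym; ↭-prep; ↭⇒↭ₛ′)
import Data.List.Relation.Binary.Permutation.Propositional.Properties as Perm
import Data.List.Relation.Binary.Permutation.Setoid.Properties as PermSetoid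
open import Data.List.Relation.Binary.Subset.Propositional using (_⊆_)
open import Data.List.Relation.Unary.All as All using (All)
import Data.List.Relation.Unary.All.Properties as All
open import Data.List.Relation.Unary.AllPairs using ([]; _∷_)
open import Data.List.Relation.Unary.Any using (here; there)
open import Data.List.Relation.Unary.Unique.Propositional using (Unique)
open import Data.List.Relation.Unary.Unique.Propositional.Properties using (upTo⁺; filter⁺; cartesianProduct⁺; ++⁺)
import Data.Maybe as Maybe
open import Data.Nat as ℕ using (ℕ; zero; suc; NonZero; _≤_; _<_)
import Data.Nat.Properties as ℕP
open import Data.Nat.Coprimality as Coprime using (Coprime)
open import Data.Nat.Divisibility as ℕD using (_∣_; _∣?_; divides)
open import Data.Nat.DivMod as ℕM using (_/_; _%_; 0/n≡0)
open import Data.Nat.GCD using (gcd; gcd[m,n]∣m; gcd[m,n]∣n; gcd-greatest)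
open import Data.Nat.Induction using (<-rec)
open import Data.Nat.ListAction using (product)
open import Data.Nat.Primality using (Prime; prime?; ¬prime[1]; prime⇒irreducible; prime⇒nonZero; prime⇒nonTrivial; euclidsLemma)
open import Data.Nat.Primality.Factorisation using (factorise)
open import Data.Product using (_×_; _,_; proj₁; proj₂; ∃-syntax)
import Data.Sign as Sign
open import Data.Sum using (_⊎_; inj₁; inj₂)
open import Function using (_∘_; _⇔_; mk⇔; Equivalence)
open import Relation.Nullary using (¬_; Dec; yes; no; contradiction)
open import Relation.Nullary.Decidable using (_×-dec_; ¬?; dec⇒maybe)
open import Relation.Unary using (Decidable)
open import Relation.Binary.PropositionalEquality as P using (_≡_; _≢_)

module _ {A : Set} where

  private
    remove : {u : A} {ys : List A} → u ∈ ys → List A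
    remove u∈ys = let (as , bs , _) = ∈-∃++ u∈ys in as ++ bs

    ↭-remove : {u : A} {ys : List A} (u∈ys : u ∈ ys) → ys ↭ u ∷ remove u∈ys
    ↭-remove {u} u∈ys with ∈-∃++ u∈ys
    ... | as , bs , P.refl = Perm.shift u as bs

  ⊆∧length⇒↭ : {us ys : List A} → Unique us → us ⊆ ys → length us ≡ length ys → us ↭ ys
  ⊆∧length⇒↭ {[]} {[]} _ _ _ = ↭-refl
  ⊆∧length⇒↭ {u ∷ us} {ys} (u∉us ∷ uniq) us⊆ys |us|≡|ys| =
    ↭-trans (↭-prep u (⊆∧length⇒↭ uniq us⊆rest |us|≡|rest|)) (↭-sym (↭-remove u∈ys))
    where
    u∈ys = us⊆ys (here P.refl)
    us⊆rest : us ⊆ remove u∈ys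
    us⊆rest x∈us with Perm.∈-resp-↭ (↭-remove u∈ys) (us⊆ys (there x∈us))
    ... | here x≡u = ⊥-elim (All.lookup u∉us x∈us (P.sym x≡u))
    ... | there x∈rest = x∈rest
    |us|≡|rest| : length us ≡ length (remove u∈ys)
    |us|≡|rest| = ℕP.suc-injective (P.trans |us|≡|ys| (Perm.↭-length (↭-remove u∈ys)))

  unique-map⁺ : {B : Set} (f : A → B) {xs : List A} → Unique xs →
                (∀ {x y} → x ∈ xs → y ∈ xs → f x ≡ f y → x ≡ y) → Unique (map f xs)
  unique-map⁺ f {[]} _ _ = []
  unique-map⁺ f {x ∷ xs} (x∉xs ∷ uniq) inj =
    All.map⁺ (All.tabulate (λ y∈xs fx≡fy → All.lookup x∉xs y∈xs (inj (here P.refl) (there y∈xs) fx≡fy)))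
    ∷ unique-map⁺ f uniq (λ x∈ y∈ → inj (there x∈) (there y∈))

  ↭-fromSameElements : {xs ys : List A} → Unique xs → Unique ys → xs ⊆ ys → ys ⊆ xs → xs ↭ ys
  ↭-fromSameElements uxs uys xs⊆ys ys⊆xs = ∼bag⇒↭ (unique∧set⇒bag uxs uys (mk⇔ xs⊆ys ys⊆xs))

map-↭-injection : {A B : Set} (f : A → B) {xs : List A} {ys : List B} → Unique xs →
  (∀ {x y} → x ∈ xs → y ∈ xs → f x ≡ f y → x ≡ y) →
  (∀ {x} → x ∈ xs → f x ∈ ys) → length xs ≡ length ys → map f xs ↭ ys
map-↭-injection f {xs} uniq inj into |xs|≡|ys| =
  ⊆∧length⇒↭ (unique-map⁺ f uniq inj)
    (λ fx∈ → let (x , x∈xs , y≡fx) = ∈-map⁻ f fx∈ in P.subst (_∈ _) (P.sym y≡fx) (into x∈xs))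
    (P.trans (List.length-map f xs) |xs|≡|ys|)

length-cartesianProduct : {A B : Set} (xs : List A) (ys : List B) →
  length (cartesianProduct xs ys) ≡ length xs ℕ.* length ys
length-cartesianProduct [] ys = P.refl
length-cartesianProduct (x ∷ xs) ys =
  P.trans (List.length-++ (map (x ,_) ys))
          (P.cong₂ ℕ._+_ (List.length-map (x ,_) ys) (length-cartesianProduct xs ys))

infix 4 _≡_mod_
record _≡_mod_ (x y : ℤ) (q : ℕ) : Set where
  constructor congruent
  field
    quotient : ℤ
    equation : x ≡ y ℤ.+ quotient ℤ.* + q

module _ where
  open +-*-Solver

  mod-refl : ∀ {q} x → x ≡ x mod q
  mod-refl x = congruent (+ 0) (P.sym (ℤP.+-identityʳ x))

  mod-sym : ∀ {q x y} → x ≡ y mod q → y ≡ x mod q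
  mod-sym {q} {x} {y} (congruent k P.refl) = congruent (ℤ.- k) (lemma y k (+ q))
    where
    lemma : ∀ y k q → y ≡ y ℤ.+ k ℤ.* q ℤ.+ ℤ.- k ℤ.* q
    lemma = solve 3 (λ y k q → y := y :+ k :* q :+ (:- k) :* q) P.refl

  mod-trans : ∀ {q x y z} → x ≡ y mod q → y ≡ z mod q → x ≡ z mod q
  mod-trans {q} {z = z} (congruent k P.refl) (congruent l P.refl) = congruent (l ℤ.+ k) (lemma z l k (+ q))
    where
    lemma : ∀ z l k q → z ℤ.+ l ℤ.* q ℤ.+ k ℤ.* q ≡ z ℤ.+ (l ℤ.+ k) ℤ.* q
    lemma = solve 4 (λ z l k q → z :+ l :* q :+ k :* q := z :+ (l :+ k) :* q) P.refl

  mod-+ : ∀ {q x y u v} → x ≡ y mod q → u ≡ v mod q → x ℤ.+ u ≡ y ℤ.+ v mod q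
  mod-+ {q} {y = y} {v = v} (congruent k P.refl) (congruent l P.refl) = congruent (k ℤ.+ l) (lemma y v k l (+ q))
    where
    lemma : ∀ y v k l q → (y ℤ.+ k ℤ.* q) ℤ.+ (v ℤ.+ l ℤ.* q) ≡ (y ℤ.+ v) ℤ.+ (k ℤ.+ l) ℤ.* q
    lemma = solve 5 (λ y v k l q → (y :+ k :* q) :+ (v :+ l :* q) := (y :+ v) :+ (k :+ l) :* q) P.refl

  mod-* : ∀ {q x y u v} → x ≡ y mod q → u ≡ v mod q → x ℤ.* u ≡ y ℤ.* v mod q
  mod-* {q} {y = y} {v = v} (congruent k P.refl) (congruent l P.refl) =
    congruent (k ℤ.* v ℤ.+ (y ℤ.+ k ℤ.* + q) ℤ.* l) (lemma y v k l (+ q))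
    where
    lemma : ∀ y v k l q → (y ℤ.+ k ℤ.* q) ℤ.* (v ℤ.+ l ℤ.* q) ≡ y ℤ.* v ℤ.+ (k ℤ.* v ℤ.+ (y ℤ.+ k ℤ.* q) ℤ.* l) ℤ.* q
    lemma = solve 5 (λ y v k l q → (y :+ k :* q) :* (v :+ l :* q) := y :* v :+ (k :* v :+ (y :+ k :* q) :* l) :* q) P.refl

  mod-*ˡ : ∀ {q x y} c → x ≡ y mod q → c ℤ.* x ≡ c ℤ.* y mod q
  mod-*ˡ c = mod-* (mod-refl c)

  mod-∣ : ∀ {d q x y} → d ∣ q → x ≡ y mod q → x ≡ y mod d
  mod-∣ {d} {y = y} (divides t P.refl) (congruent k P.refl) =
    congruent (k ℤ.* + t) (P.cong (λ w → y ℤ.+ w) (P.trans (P.cong (k ℤ.*_) (ℤP.pos-* t d)) (P.sym (ℤP.*-assoc k (+ t) (+ d)))))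

  mod-scale : ∀ t {q x y} → x ≡ y mod q → + t ℤ.* x ≡ + t ℤ.* y mod (t ℕ.* q)
  mod-scale t {q} {y = y} (congruent k P.refl) = congruent k (P.trans (lemma (+ t) y k (+ q)) (P.cong (λ w → + t ℤ.* y ℤ.+ k ℤ.* w) (P.sym (ℤP.pos-* t q))))
    where
    lemma : ∀ t y k q → t ℤ.* (y ℤ.+ k ℤ.* q) ≡ t ℤ.* y ℤ.+ k ℤ.* (t ℤ.* q)
    lemma = solve 4 (λ t y k q → t :* (y :+ k :* q) := t :* y :+ k :* (t :* q)) P.refl

  x*q≡0-mod : ∀ {q} x → x ℤ.* + q ≡ + 0 mod q
  x*q≡0-mod x = congruent x (P.sym (ℤP.+-identityˡ _))

  ≡mod⇒-≡0 : ∀ {q x y} → x ≡ y mod q → x ℤ.- y ≡ + 0 mod q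
  ≡mod⇒-≡0 {q} {y = y} (congruent k P.refl) = congruent k (lemma y (k ℤ.* + q))
    where
    lemma : ∀ y z → y ℤ.+ z ℤ.- y ≡ + 0 ℤ.+ z
    lemma = solve 2 (λ y z → y :+ z :- y := con (+ 0) :+ z) P.refl

  -≡0⇒≡mod : ∀ {q x y} → x ℤ.- y ≡ + 0 mod q → x ≡ y mod q
  -≡0⇒≡mod {q} {x} {y} (congruent k e) =
    congruent k (P.trans (lemma x y) (P.cong (λ w → y ℤ.+ w) (P.trans e (ℤP.+-identityˡ _))))
    where
    lemma : ∀ x y → x ≡ y ℤ.+ (x ℤ.- y)
    lemma = solve 2 (λ x y → x := y :+ (x :- y)) P.refl

mod-scale-cofactor : ∀ {N q x y} .{{_ : NonZero q}} → q ∣ N → x ≡ y mod q →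
  + (N / q) ℤ.* x ≡ + (N / q) ℤ.* y mod N
mod-scale-cofactor {N} {q} {x} {y} q∣N x≡y =
  P.subst (+ (N / q) ℤ.* x ≡ + (N / q) ℤ.* y mod_) (ℕM.m/n*n≡m q∣N) (mod-scale (N / q) x≡y)

≡mod0⇒∣ : ∀ {q x} → x ≡ + 0 mod q → q ∣ ∣ x ∣
≡mod0⇒∣ {q} (congruent k P.refl) = divides ∣ k ∣ (P.trans (P.cong ∣_∣ (ℤP.+-identityˡ (k ℤ.* + q))) (ℤP.abs-* k (+ q)))

∣⇒≡mod0 : ∀ {q x} → q ∣ ∣ x ∣ → x ≡ + 0 mod q
∣⇒≡mod0 {q} {x} q∣x with ℤD.∣ᵤ⇒∣ {+ q} {x} q∣x
... | ℤD.divides k x≡kq = congruent k (P.trans x≡kq (P.sym (ℤP.+-identityˡ _)))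

≡-%ℕ : ∀ x q .{{_ : NonZero q}} → x ≡ + (x %ℕ q) mod q
≡-%ℕ x q = congruent (x /ℕ q) (a≡a%ℕn+[a/ℕn]*n x q)

≡mod⇒≡ : ∀ {q a b} → a ℕ.< q → b ℕ.< q → + a ≡ + b mod q → a ≡ b
≡mod⇒≡ {q} {a} {b} a<q b<q (congruent (+ zero) a≡b+0) =
  ℤP.+-injective (P.trans a≡b+0 (P.trans (P.cong (λ w → + b ℤ.+ w) (ℤP.*-zeroˡ (+ q))) (ℤP.+-identityʳ (+ b))))
≡mod⇒≡ {q} {a} {b} a<q b<q (congruent (+ suc j) a≡b+kq) = ⊥-elim (ℕP.<-irrefl P.refl (ℕP.<-≤-trans a<q q≤a))
  where
  a≡b+kq′ : a ≡ b ℕ.+ suc j ℕ.* q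
  a≡b+kq′ = ℤP.+-injective (P.trans a≡b+kq (P.trans (P.cong (λ w → + b ℤ.+ w) (P.sym (ℤP.pos-* (suc j) q))) (P.sym (ℤP.pos-+ b (suc j ℕ.* q)))))
  q≤a : q ℕ.≤ a
  q≤a = P.subst (q ℕ.≤_) (P.sym a≡b+kq′) (ℕP.≤-trans (ℕP.m≤m+n q (j ℕ.* q)) (ℕP.m≤n+m (suc j ℕ.* q) b))
≡mod⇒≡ {q} {a} {b} a<q b<q (congruent -[1+ j ] a≡b-kq) =
  P.sym (≡mod⇒≡ b<q a<q (congruent (+ suc j) (P.trans (lemma (+ b) (+ suc j) (+ q)) (P.cong (ℤ._+ + suc j ℤ.* + q) (P.sym a≡b-kq)))))
  where
  open +-*-Solver
  lemma : ∀ b j q → b ≡ b ℤ.+ (ℤ.- j) ℤ.* q ℤ.+ j ℤ.* q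
  lemma = solve 3 (λ b j q → b := b :+ (:- j) :* q :+ j :* q) P.refl

≡mod⇒%ℕ≡ : ∀ {q x y} .{{_ : NonZero q}} → x ≡ y mod q → x %ℕ q ≡ y %ℕ q
≡mod⇒%ℕ≡ {q} {x} {y} x≡y = ≡mod⇒≡ (n%ℕd<d x q) (n%ℕd<d y q)
  (mod-trans (mod-sym (≡-%ℕ x q)) (mod-trans x≡y (≡-%ℕ y q)))

%ℕ-unique : ∀ {q x r} .{{_ : NonZero q}} → r ℕ.< q → x ≡ + r mod q → x %ℕ q ≡ r
%ℕ-unique {q} {x} r<q x≡r = ≡mod⇒≡ (n%ℕd<d x q) r<q (mod-trans (mod-sym (≡-%ℕ x q)) x≡r)

≡-%-shift : ∀ q .{{_ : NonZero q}} m t → + ((m ℕ.+ t) % q) ≡ + m ℤ.+ + t mod q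
≡-%-shift q m t = P.subst (+ ((m ℕ.+ t) % q) ≡_mod q) (ℤP.pos-+ m t) (mod-sym (≡-%ℕ (+ (m ℕ.+ t)) q))

evalF-cong : ∀ (F : LinFactors) {q x y} → x ≡ y mod q → evalF F x ≡ evalF F y mod q
evalF-cong [] _ = mod-refl (+ 1)
evalF-cong ((a , b) ∷ F) x≡y = mod-* (mod-+ (mod-*ˡ a x≡y) (mod-refl b)) (evalF-cong F x≡y)

coprime-cong-mod : ∀ {q x y} → x ≡ y mod q → Coprime q ∣ x ∣ → Coprime q ∣ y ∣
coprime-cong-mod {q} {x} {y} (congruent k x≡y+kq) coprime {i} (i∣q , i∣y) = coprime (i∣q , i∣x)
  where
  i∣x : i ∣ ∣ x ∣
  i∣x = ℤD.∣⇒∣ᵤ {+ i} {x} (P.subst (ℤD._∣_ (+ i)) (P.sym x≡y+kq)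
          (ℤD.∣m∣n⇒∣m+n (ℤD.∣ᵤ⇒∣ {+ i} {y} i∣y) (ℤD.∣n⇒∣m*n k (ℤD.∣ᵤ⇒∣ {+ i} {+ q} i∣q))))

coprime-∣ˡ : ∀ {a d x} → d ∣ a → Coprime a x → Coprime d x
coprime-∣ˡ d∣a coprime (i∣d , i∣x) = coprime (ℕD.∣-trans i∣d d∣a , i∣x)

coprime-∣ʳ : ∀ {a d x} → d ∣ x → Coprime a x → Coprime a d
coprime-∣ʳ d∣x coprime (i∣a , i∣d) = coprime (i∣a , ℕD.∣-trans i∣d d∣x)

coprime-*ˡ : ∀ {d e x} → Coprime d x → Coprime e x → Coprime (d ℕ.* e) x
coprime-*ˡ {d} {e} {x} d⊥x e⊥x {i} (i∣de , i∣x) = e⊥x (i∣e , i∣x)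
  where
  i∣e : i ∣ e
  i∣e = Coprime.coprime-divisor (Coprime.gcd≡1⇒coprime (d⊥x (gcd[m,n]∣n i d , ℕD.∣-trans (gcd[m,n]∣m i d) i∣x))) i∣de

coprime-*ʳ : ∀ {x d e} → Coprime x d → Coprime x e → Coprime x (d ℕ.* e)
coprime-*ʳ x⊥d x⊥e = Coprime.sym (coprime-*ˡ (Coprime.sym x⊥d) (Coprime.sym x⊥e))

coprime-∣-* : ∀ {d e z} → Coprime d e → d ∣ z → e ∣ z → d ℕ.* e ∣ z
coprime-∣-* {d} {e} d⊥e d∣z (divides k P.refl) = ℕD.*-monoˡ-∣ e d∣k
  where
  d∣k : d ∣ k
  d∣k = Coprime.coprime-divisor d⊥e (P.subst (d ∣_) (ℕP.*-comm k e) d∣z)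

prime-∣⊎coprime : ∀ {p} x → Prime p → p ∣ x ⊎ Coprime p x
prime-∣⊎coprime {p} x p-prime with prime⇒irreducible p-prime (gcd[m,n]∣m p x)
... | inj₁ gcd≡1 = inj₂ (Coprime.gcd≡1⇒coprime gcd≡1)
... | inj₂ gcd≡p = inj₁ (P.subst (_∣ x) gcd≡p (gcd[m,n]∣n p x))

prime-∤⇒coprime : ∀ {p x} → Prime p → ¬ p ∣ x → Coprime p x
prime-∤⇒coprime {x = x} p-prime p∤x with prime-∣⊎coprime x p-prime
... | inj₁ p∣x = ⊥-elim (p∤x p∣x)
... | inj₂ p⊥x = p⊥x

prime≢1 : ∀ {p} → Prime p → p ≢ 1
prime≢1 p-prime P.refl = ¬prime[1] p-prime

prime⇒>1 : ∀ {p} → Prime p → 1 ℕ.< p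
prime⇒>1 {p} p-prime = ℕ.nonTrivial⇒n>1 p {{prime⇒nonTrivial p-prime}}

<prime⇒coprime : ∀ {p a} → Prime p → a ℕ.< p → a ≢ 0 → Coprime a p
<prime⇒coprime {a = zero} _ _ a≢0 = ⊥-elim (a≢0 P.refl)
<prime⇒coprime {a = suc a} p-prime a<p _ = Coprime.sym (Coprime.prime⇒coprime p-prime a<p)

¬coprime-0-prime : ∀ {p} → Prime p → ¬ Coprime 0 p
¬coprime-0-prime p-prime coprime = prime≢1 p-prime (coprime (ℕD._∣0 _ , ℕD.∣-refl))

prime-factor : ∀ k → ∃[ p ] (Prime p × p ∣ suc (suc k))
prime-factor k with factorise (suc (suc k))
... | record { factors = p ∷ ps ; isFactorisation = 2+k≡p*ps ; factorsPrime = p-prime All.∷ _ } =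
  p , p-prime , divides (product ps) (P.trans 2+k≡p*ps (ℕP.*-comm p (product ps)))

mod-coprime-* : ∀ {d e x y} → Coprime d e → x ≡ y mod d → x ≡ y mod e → x ≡ y mod (d ℕ.* e)
mod-coprime-* d⊥e x≡y[d] x≡y[e] =
  -≡0⇒≡mod (∣⇒≡mod0 (coprime-∣-* d⊥e (≡mod0⇒∣ (≡mod⇒-≡0 x≡y[d])) (≡mod0⇒∣ (≡mod⇒-≡0 x≡y[e]))))

mod-cancel-*ʳ : ∀ {d e x y} → Coprime d e → x ℤ.* + e ≡ y ℤ.* + e mod d → x ≡ y mod d
mod-cancel-*ʳ {d} {e} {x} {y} d⊥e xe≡ye = -≡0⇒≡mod (∣⇒≡mod0 d∣x-y)
  where
  open +-*-Solver
  lemma : ∀ x y e → x ℤ.* e ℤ.- y ℤ.* e ≡ (x ℤ.- y) ℤ.* e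
  lemma = solve 3 (λ x y e → x :* e :- y :* e := (x :- y) :* e) P.refl
  d∣[x-y]e : d ∣ ∣ (x ℤ.- y) ℤ.* + e ∣
  d∣[x-y]e = P.subst (λ z → d ∣ ∣ z ∣) (lemma x y (+ e)) (≡mod0⇒∣ (≡mod⇒-≡0 xe≡ye))
  d∣x-y : d ∣ ∣ x ℤ.- y ∣
  d∣x-y = Coprime.coprime-divisor d⊥e (P.subst (d ∣_) (P.trans (ℤP.abs-* (x ℤ.- y) (+ e)) (ℕP.*-comm _ e)) d∣[x-y]e)

[n/[d*e]]*e≡n/d : ∀ n d e .{{_ : NonZero d}} .{{_ : NonZero (d ℕ.* e)}} → d ℕ.* e ∣ n →
  (n / (d ℕ.* e)) ℕ.* e ≡ n / d
[n/[d*e]]*e≡n/d n d e de∣n = P.sym (P.trans (P.cong (_/ d) n≡) (ℕM.m*n/n≡m _ d))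
  where
  n≡ : n ≡ (n / (d ℕ.* e)) ℕ.* e ℕ.* d
  n≡ = P.sym (P.trans (ℕP.*-assoc (n / (d ℕ.* e)) e d) (P.trans (P.cong (n / (d ℕ.* e) ℕ.*_) (ℕP.*-comm e d)) (ℕM.m/n*n≡m de∣n)))

[n/[d*e]]*d≡n/e : ∀ n d e .{{_ : NonZero e}} .{{_ : NonZero (d ℕ.* e)}} → d ℕ.* e ∣ n →
  (n / (d ℕ.* e)) ℕ.* d ≡ n / e
[n/[d*e]]*d≡n/e n d e de∣n = P.sym (P.trans (P.cong (_/ e) n≡) (ℕM.m*n/n≡m _ e))
  where
  n≡ : n ≡ (n / (d ℕ.* e)) ℕ.* d ℕ.* e
  n≡ = P.sym (P.trans (ℕP.*-assoc (n / (d ℕ.* e)) d e) (ℕM.m/n*n≡m de∣n))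

n/d≢0 : ∀ {n d} .{{_ : NonZero d}} → d ∣ n → .{{NonZero n}} → NonZero (n / d)
n/d≢0 d∣n = ℕ.>-nonZero (ℕM.m≥n⇒m/n>0 (ℕD.∣⇒≤ d∣n))

[n/p]*x≡0⇒p∣x : ∀ {n p} .{{_ : NonZero n}} .{{_ : NonZero p}} x → p ∣ n →
  + (n / p) ℤ.* x ≡ + 0 mod n → p ∣ ∣ x ∣
[n/p]*x≡0⇒p∣x {n} {p} x p∣n [n/p]x≡0 = ℕD.*-cancelˡ-∣ (n / p) {{n/d≢0 p∣n}} [n/p]p∣[n/p]x
  where
  [n/p]p∣[n/p]x : (n / p) ℕ.* p ∣ (n / p) ℕ.* ∣ x ∣
  [n/p]p∣[n/p]x = P.subst₂ _∣_ (P.sym (ℕM.m/n*n≡m p∣n)) (ℤP.abs-* (+ (n / p)) x) (≡mod0⇒∣ [n/p]x≡0)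

module _ {n d : ℕ} .{{_ : NonZero d}} where

  private
    /-unique : ∀ {a x} → a ℕ.* d ℕ.≤ x → x ℕ.< suc a ℕ.* d → x / d ≡ a
    /-unique lo hi = ℕP.≤-antisym (ℕP.<⇒≤pred (ℕM.m<n*o⇒m/o<n hi))
      (P.subst (ℕ._≤ _ / d) (ℕM.m*n/n≡m _ d) (ℕM./-monoˡ-≤ d lo))

    n<[1+n/d]*d : n ℕ.< suc (n / d) ℕ.* d
    n<[1+n/d]*d = P.subst (ℕ._< suc (n / d) ℕ.* d) (P.sym (ℕM.m≡m%n+[m/n]*n n d)) (ℕP.+-monoˡ-< ((n / d) ℕ.* d) (ℕM.m%n<n n d))

  [1+n]/d≡1+n/d : d ∣ suc n → suc n / d ≡ suc (n / d)
  [1+n]/d≡1+n/d (divides c 1+n≡cd) = /-unique lo hi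
    where
    n/d<c : n / d ℕ.< c
    n/d<c = ℕP.*-cancelʳ-< d (n / d) c (ℕP.≤-<-trans (ℕM.m/n*n≤m n d) (P.subst (n ℕ.<_) 1+n≡cd ℕP.≤-refl))
    lo : suc (n / d) ℕ.* d ℕ.≤ suc n
    lo = P.subst (suc (n / d) ℕ.* d ℕ.≤_) (P.sym 1+n≡cd) (ℕP.*-monoˡ-≤ d n/d<c)
    hi : suc n ℕ.< suc (suc (n / d)) ℕ.* d
    hi = ℕP.≤-<-trans n<[1+n/d]*d (ℕP.m<n+m (suc (n / d) ℕ.* d) (ℕ.>-nonZero⁻¹ d))

  [1+n]/d≡n/d : ¬ d ∣ suc n → suc n / d ≡ n / d
  [1+n]/d≡n/d d∤1+n = /-unique (ℕP.≤-trans (ℕM.m/n*n≤m n d) (ℕP.n≤1+n n)) hi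
    where
    hi : suc n ℕ.< suc (n / d) ℕ.* d
    hi with ℕP.m≤n⇒m<n∨m≡n n<[1+n/d]*d
    ... | inj₁ lt = lt
    ... | inj₂ eq = ⊥-elim (d∤1+n (divides (suc (n / d)) eq))

module _ (d e : ℕ) .{{_ : NonZero d}} .{{_ : NonZero e}} where

  private instance
    de≢0 : NonZero (d ℕ.* e)
    de≢0 = ℕP.m*n≢0 d e

  private
    length-upTo-d×upTo-e : length (cartesianProduct (upTo d) (upTo e)) ≡ length (upTo (d ℕ.* e))
    length-upTo-d×upTo-e = P.trans (length-cartesianProduct (upTo d) (upTo e))
      (P.trans (P.cong₂ ℕ._*_ (List.length-upTo d) (List.length-upTo e)) (P.sym (List.length-upTo _)))

  crt-split-↭ : Coprime d e → map (λ m → (m % d , m % e)) (upTo (d ℕ.* e)) ↭ cartesianProduct (upTo d) (upTo e)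
  crt-split-↭ d⊥e = map-↭-injection _ (upTo⁺ _) inj into (P.sym length-upTo-d×upTo-e)
    where
    ≡-% : ∀ {x y} k .{{_ : NonZero k}} → x % k ≡ y % k → + x ≡ + y mod k
    ≡-% {x} {y} k x%k≡y%k = mod-trans (≡-%ℕ (+ x) k) (P.subst (λ z → + z ≡ + y mod k) (P.sym x%k≡y%k) (mod-sym (≡-%ℕ (+ y) k)))
    inj : ∀ {x y} → x ∈ upTo (d ℕ.* e) → y ∈ upTo (d ℕ.* e) → (x % d , x % e) ≡ (y % d , y % e) → x ≡ y
    inj x∈ y∈ eq = ≡mod⇒≡ (∈-upTo⁻ x∈) (∈-upTo⁻ y∈) (mod-coprime-* d⊥e (≡-% d (P.cong proj₁ eq)) (≡-% e (P.cong proj₂ eq)))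
    into : ∀ {x} → x ∈ upTo (d ℕ.* e) → (x % d , x % e) ∈ cartesianProduct (upTo d) (upTo e)
    into {x} _ = ∈-cartesianProduct⁺ (∈-upTo⁺ (ℕM.m%n<n x d)) (∈-upTo⁺ (ℕM.m%n<n x e))

  crt-join : ℕ × ℕ → ℕ
  crt-join (x , y) = (x ℕ.* e ℕ.+ y ℕ.* d) % (d ℕ.* e)

  crt-join-≡ : ∀ x y → + crt-join (x , y) ≡ + x ℤ.* + e ℤ.+ + y ℤ.* + d mod (d ℕ.* e)
  crt-join-≡ x y = P.subst (+ crt-join (x , y) ≡_mod (d ℕ.* e))
    (P.trans (ℤP.pos-+ (x ℕ.* e) (y ℕ.* d)) (P.cong₂ ℤ._+_ (ℤP.pos-* x e) (ℤP.pos-* y d)))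
    (mod-sym (≡-%ℕ (+ (x ℕ.* e ℕ.+ y ℕ.* d)) (d ℕ.* e)))

  crt-join-↭ : Coprime d e → map crt-join (cartesianProduct (upTo d) (upTo e)) ↭ upTo (d ℕ.* e)
  crt-join-↭ d⊥e = map-↭-injection _ (cartesianProduct⁺ (upTo⁺ d) (upTo⁺ e)) inj
    (λ _ → ∈-upTo⁺ (ℕM.m%n<n _ (d ℕ.* e))) length-upTo-d×upTo-e
    where
    lin : ℕ × ℕ → ℤ
    lin (x , y) = + x ℤ.* + e ℤ.+ + y ℤ.* + d
    inj : ∀ {u v} → u ∈ cartesianProduct (upTo d) (upTo e) → v ∈ cartesianProduct (upTo d) (upTo e) →
          crt-join u ≡ crt-join v → u ≡ v
    inj {x , y} {x′ , y′} u∈ v∈ eq = P.cong₂ _,_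
      (≡mod⇒≡ (∈-upTo⁻ (proj₁ u∈′)) (∈-upTo⁻ (proj₁ v∈′)) (mod-cancel-*ʳ d⊥e xe≡x′e))
      (≡mod⇒≡ (∈-upTo⁻ (proj₂ u∈′)) (∈-upTo⁻ (proj₂ v∈′)) (mod-cancel-*ʳ (Coprime.sym d⊥e) yd≡y′d))
      where
      u∈′ = ∈-cartesianProduct⁻ (upTo d) (upTo e) u∈
      v∈′ = ∈-cartesianProduct⁻ (upTo d) (upTo e) v∈
      lin≡ : lin (x , y) ≡ lin (x′ , y′) mod (d ℕ.* e)
      lin≡ = mod-trans (mod-sym (crt-join-≡ x y)) (P.subst (λ z → + z ≡ lin (x′ , y′) mod (d ℕ.* e)) (P.sym eq) (crt-join-≡ x′ y′))
      xe≡x′e : + x ℤ.* + e ≡ + x′ ℤ.* + e mod d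
      xe≡x′e = mod-trans (mod-sym (congruent (+ y) P.refl)) (mod-trans (mod-∣ (ℕD.m∣m*n e) lin≡) (congruent (+ y′) P.refl))
      yd≡y′d : + y ℤ.* + d ≡ + y′ ℤ.* + d mod e
      yd≡y′d = mod-trans (mod-sym (congruent (+ x) (ℤP.+-comm (+ x ℤ.* + e) (+ y ℤ.* + d))))
                 (mod-trans (mod-∣ (ℕD.n∣m*n d) lin≡) (congruent (+ x′) (ℤP.+-comm (+ x′ ℤ.* + e) (+ y′ ℤ.* + d))))

  private
    coprime-≡mod : ∀ {q j k} → + j ≡ + k mod q → Coprime j q → Coprime k q
    coprime-≡mod {q} {j} {k} j≡k j⊥q = Coprime.sym {q} {k} (coprime-cong-mod j≡k (Coprime.sym {j} {q} j⊥q))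

    coprime-cofactor : ∀ {q r x j} → Coprime q r → + j ≡ + (x ℕ.* r) mod q → Coprime j q ⇔ Coprime x q
    coprime-cofactor {q} {r} {x} {j} q⊥r j≡xr = mk⇔ to from
      where
      to : Coprime j q → Coprime x q
      to j⊥q = Coprime.sym (coprime-∣ʳ (ℕD.m∣m*n r) (Coprime.sym (coprime-≡mod j≡xr j⊥q)))
      from : Coprime x q → Coprime j q
      from x⊥q = coprime-≡mod (mod-sym j≡xr) (Coprime.sym (coprime-*ʳ (Coprime.sym x⊥q) q⊥r))

  coprime-crt-join : Coprime d e → ∀ x y → Coprime (crt-join (x , y)) (d ℕ.* e) ⇔ (Coprime x d × Coprime y e)
  coprime-crt-join d⊥e x y = mk⇔ to from
    where
    j = crt-join (x , y)
    j≡ : + crt-join (x , y) ≡ + x ℤ.* + e ℤ.+ + y ℤ.* + d mod (d ℕ.* e)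
    j≡ = crt-join-≡ x y
    coprimeˡ : Coprime (crt-join (x , y)) d ⇔ Coprime x d
    coprimeˡ = coprime-cofactor d⊥e (P.subst (+ crt-join (x , y) ≡_mod d) (P.sym (ℤP.pos-* x e))
                 (mod-trans (mod-∣ (ℕD.m∣m*n e) j≡) (congruent (+ y) P.refl)))
    coprimeʳ : Coprime (crt-join (x , y)) e ⇔ Coprime y e
    coprimeʳ = coprime-cofactor (Coprime.sym d⊥e) (P.subst (+ crt-join (x , y) ≡_mod e) (P.sym (ℤP.pos-* y d))
                 (mod-trans (mod-∣ (ℕD.n∣m*n d) j≡) (congruent (+ x) (ℤP.+-comm (+ x ℤ.* + e) (+ y ℤ.* + d)))))
    to : Coprime j (d ℕ.* e) → Coprime x d × Coprime y e
    to j⊥de = Equivalence.to coprimeˡ (coprime-∣ʳ (ℕD.m∣m*n e) j⊥de) , Equivalence.to coprimeʳ (coprime-∣ʳ (ℕD.n∣m*n d) j⊥de)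
    from : Coprime x d × Coprime y e → Coprime j (d ℕ.* e)
    from (x⊥d , y⊥e) = coprime-*ʳ (Equivalence.from coprimeˡ x⊥d) (Equivalence.from coprimeʳ y⊥e)

shift-%-↭ : ∀ q t .{{_ : NonZero q}} → map (λ m → (m ℕ.+ t) % q) (upTo q) ↭ upTo q
shift-%-↭ q t = map-↭-injection _ (upTo⁺ q) inj (λ _ → ∈-upTo⁺ (ℕM.m%n<n _ q)) P.refl
  where
  inj : ∀ {x y} → x ∈ upTo q → y ∈ upTo q → (x ℕ.+ t) % q ≡ (y ℕ.+ t) % q → x ≡ y
  inj {x} {y} x∈ y∈ eq = ≡mod⇒≡ (∈-upTo⁻ x∈) (∈-upTo⁻ y∈)
    (P.subst₂ (_≡_mod q) (cancel (+ x)) (cancel (+ y)) (mod-+ x+t≡y+t (mod-refl (ℤ.- (+ t)))))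
    where
    x+t≡y+t : + x ℤ.+ + t ≡ + y ℤ.+ + t mod q
    x+t≡y+t = mod-trans (mod-sym (≡-%-shift q x t)) (P.subst (λ z → + z ≡ + y ℤ.+ + t mod q) (P.sym eq) (≡-%-shift q y t))
    cancel : ∀ a → a ℤ.+ + t ℤ.+ ℤ.- (+ t) ≡ a
    cancel a = P.trans (ℤP.+-assoc a (+ t) (ℤ.- + t)) (P.trans (P.cong (λ w → a ℤ.+ w) (ℤP.+-inverseʳ (+ t))) (ℤP.+-identityʳ a))

SquareFree : ℕ → Set
SquareFree q = ∀ d → 2 ℕ.≤ d → ¬ (d ℕ.* d ∣ q)

private
  squareDivisor? : ∀ q → Decidable (λ d → 2 ℕ.≤ d × d ℕ.* d ∣ q)
  squareDivisor? q d = (2 ℕ.≤? d) ×-dec ((d ℕ.* d) ∣? q)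

  ∣⇒∈upTo : ∀ {d q} .{{_ : NonZero q}} → d ∣ q → d ∈ upTo (suc q)
  ∣⇒∈upTo d∣q = ∈-upTo⁺ (ℕ.s≤s (ℕD.∣⇒≤ d∣q))

  d*d∣⇒∈upTo : ∀ {d q} .{{_ : NonZero q}} → d ℕ.* d ∣ q → d ∈ upTo (suc q)
  d*d∣⇒∈upTo {zero} _ = ∈-upTo⁺ (ℕ.s≤s ℕ.z≤n)
  d*d∣⇒∈upTo {suc d} dd∣q = ∣⇒∈upTo (ℕD.∣-trans (ℕD.m∣m*n (suc d)) dd∣q)

squarefree?≡true : ∀ {q} → SquareFree q → squarefree? q ≡ true
squarefree?≡true {q} sf
  rewrite List.filter-none (squareDivisor? q) {upTo (suc q)} (All.tabulate (λ {d} _ (2≤d , dd∣q) → sf d 2≤d dd∣q))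
  = P.refl

squarefree?≡false : ∀ {q d} .{{_ : NonZero q}} → 2 ℕ.≤ d → d ℕ.* d ∣ q → squarefree? q ≡ false
squarefree?≡false {q} {d} 2≤d dd∣q with length (filter (squareDivisor? q) (upTo (suc q))) ℕ.≟ 0
... | no _ = P.refl
... | yes |filter|≡0 = ⊥-elim (ℕP.<⇒≢ (List.filter-some (squareDivisor? q) (lose (d*d∣⇒∈upTo dd∣q) (2≤d , dd∣q))) (P.sym |filter|≡0))

squarefree?-spec : ∀ q .{{_ : NonZero q}} →
  (squarefree? q ≡ true × SquareFree q) ⊎ (squarefree? q ≡ false × ∃[ d ] (2 ℕ.≤ d × d ℕ.* d ∣ q))
squarefree?-spec q with filter (squareDivisor? q) (upTo (suc q)) in eq
... | [] = inj₁ (P.refl , squareFree)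
  where
  squareFree : SquareFree q
  squareFree d 2≤d dd∣q = ℕP.<⇒≢ (List.filter-some (squareDivisor? q) (lose (d*d∣⇒∈upTo dd∣q) (2≤d , dd∣q))) (P.sym (P.cong length eq))
... | d ∷ _ = inj₂ (P.refl , d , proj₂ (∈-filter⁻ (squareDivisor? q) {xs = upTo (suc q)} (P.subst (d ∈_) (P.sym eq) (here P.refl))))

private
  primeDivisor? : ∀ q → Decidable (λ p → Prime p × p ∣ q)
  primeDivisor? q p = prime? p ×-dec (p ∣? q)

∈-primeDivisors⁺ : ∀ {q p} .{{_ : NonZero q}} → Prime p → p ∣ q → p ∈ primeDivisors q
∈-primeDivisors⁺ {q} p-prime p∣q = ∈-filter⁺ (primeDivisor? q) (∣⇒∈upTo p∣q) (p-prime , p∣q)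

∈-primeDivisors⁻ : ∀ {q p} → p ∈ primeDivisors q → Prime p × p ∣ q
∈-primeDivisors⁻ {q} p∈ = proj₂ (∈-filter⁻ (primeDivisor? q) {xs = upTo (suc q)} p∈)

primeDivisors-* : ∀ {p m} .{{_ : NonZero m}} → Prime p → ¬ p ∣ m → primeDivisors (p ℕ.* m) ↭ p ∷ primeDivisors m
primeDivisors-* {p} {m} p-prime p∤m =
  ↭-fromSameElements (filter⁺ (primeDivisor? (p ℕ.* m)) (upTo⁺ (suc (p ℕ.* m)))) (p∉ ∷ filter⁺ (primeDivisor? m) (upTo⁺ (suc m))) sub sup
  where
  instance _ = ℕP.m*n≢0 p m {{prime⇒nonZero p-prime}}
  p∉ : All (p ≢_) (primeDivisors m)
  p∉ = All.tabulate (λ x∈ p≡x → p∤m (P.subst (_∣ m) (P.sym p≡x) (proj₂ (∈-primeDivisors⁻ x∈))))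
  sub : primeDivisors (p ℕ.* m) ⊆ p ∷ primeDivisors m
  sub x∈ with ∈-primeDivisors⁻ x∈
  ... | x-prime , x∣pm with euclidsLemma p m x-prime x∣pm
  ...   | inj₂ x∣m = there (∈-primeDivisors⁺ x-prime x∣m)
  ...   | inj₁ x∣p with prime⇒irreducible p-prime x∣p
  ...     | inj₁ x≡1 = ⊥-elim (prime≢1 x-prime x≡1)
  ...     | inj₂ x≡p = here x≡p
  sup : p ∷ primeDivisors m ⊆ primeDivisors (p ℕ.* m)
  sup (here P.refl) = ∈-primeDivisors⁺ p-prime (ℕD.m∣m*n m)
  sup (there x∈) = let (x-prime , x∣m) = ∈-primeDivisors⁻ x∈ in ∈-primeDivisors⁺ x-prime (ℕD.∣n⇒∣m*n p x∣m)

squarefree?-* : ∀ {p m} .{{_ : NonZero m}} → Prime p → ¬ p ∣ m → squarefree? (p ℕ.* m) ≡ squarefree? m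
squarefree?-* {p} {m} p-prime p∤m with squarefree?-spec m
... | inj₁ (sf≡true , m-sf) = P.trans (squarefree?≡true pm-sf) (P.sym sf≡true)
  where
  pm-sf : SquareFree (p ℕ.* m)
  pm-sf d 2≤d dd∣pm with prime-∣⊎coprime d p-prime
  ... | inj₁ p∣d = p∤m (ℕD.*-cancelˡ-∣ p {{prime⇒nonZero p-prime}}
                     (ℕD.∣-trans (ℕD.∣-trans (ℕD.*-monoˡ-∣ p p∣d) (ℕD.*-monoʳ-∣ d p∣d)) dd∣pm))
  ... | inj₂ p⊥d = m-sf d 2≤d (Coprime.coprime-divisor (coprime-*ˡ (Coprime.sym p⊥d) (Coprime.sym p⊥d)) dd∣pm)
... | inj₂ (sf≡false , d , 2≤d , dd∣m) =
  P.trans (squarefree?≡false {{ℕP.m*n≢0 p m {{prime⇒nonZero p-prime}}}} 2≤d (ℕD.∣n⇒∣m*n p dd∣m)) (P.sym sf≡false)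

μ[p*m]≡-μ[m] : ∀ {p m} .{{_ : NonZero m}} → Prime p → ¬ p ∣ m → μ (p ℕ.* m) ≡ ℤ.- μ m
μ[p*m]≡-μ[m] {p} {m} p-prime p∤m
  rewrite squarefree?-* p-prime p∤m | Perm.↭-length (primeDivisors-* p-prime p∤m) with squarefree? m
... | true = ℤP.-1*i≡-i _
... | false = P.refl

p*p∣q⇒μ≡0 : ∀ {p q} .{{_ : NonZero q}} → Prime p → p ℕ.* p ∣ q → μ q ≡ + 0
p*p∣q⇒μ≡0 p-prime pp∣q rewrite squarefree?≡false (prime⇒>1 p-prime) pp∣q = P.refl

μ≡0⊎μ²≡1 : ∀ q → μ q ≡ + 0 ⊎ μ q ℤ.* μ q ≡ + 1
μ≡0⊎μ²≡1 q with squarefree? q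
... | false = inj₁ P.refl
... | true = inj₂ (sq (length (primeDivisors q)))
  where
  sq : ∀ k → powℤ -[1+ 0 ] k ℤ.* powℤ -[1+ 0 ] k ≡ + 1
  sq zero = P.refl
  sq (suc k) = P.trans (lemma (powℤ -[1+ 0 ] k)) (sq k)
    where
    open +-*-Solver
    lemma : ∀ x → -[1+ 0 ] ℤ.* x ℤ.* (-[1+ 0 ] ℤ.* x) ≡ x ℤ.* x
    lemma = solve 1 (λ x → (:- con (+ 1)) :* x :* ((:- con (+ 1)) :* x) := x :* x) P.refl

divisors : ℕ → List ℕ
divisors q = filter (_∣? q) (upTo (suc q))

∈-divisors⁺ : ∀ {q d} .{{_ : NonZero q}} → d ∣ q → d ∈ divisors q
∈-divisors⁺ {q} d∣q = ∈-filter⁺ (_∣? q) (∣⇒∈upTo d∣q) d∣q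

∈-divisors⁻ : ∀ {q d} → d ∈ divisors q → d ∣ q
∈-divisors⁻ {q} d∈ = proj₂ (∈-filter⁻ (_∣? q) {xs = upTo (suc q)} d∈)

divisor≢0 : ∀ {q d} .{{_ : NonZero q}} → d ∈ divisors q → NonZero d
divisor≢0 {q} {zero} d∈ = ⊥-elim (ℕ.≢-nonZero⁻¹ q (ℕD.0∣⇒≡0 (∈-divisors⁻ d∈)))
divisor≢0 {q} {suc d} _ = _

divisors-* : ∀ {p q} .{{_ : NonZero q}} → Prime p → ¬ p ∣ q → divisors (p ℕ.* q) ↭ divisors q ++ map (p ℕ.*_) (divisors q)
divisors-* {p} {q} p-prime p∤q = ↭-fromSameElements (filter⁺ (_∣? p ℕ.* q) (upTo⁺ (suc (p ℕ.* q)))) unique sub sup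
  where
  instance _ = prime⇒nonZero p-prime
  instance _ = ℕP.m*n≢0 p q
  unique : Unique (divisors q ++ map (p ℕ.*_) (divisors q))
  unique = ++⁺ (filter⁺ (_∣? q) (upTo⁺ (suc q))) (unique-map⁺ (p ℕ.*_) (filter⁺ (_∣? q) (upTo⁺ (suc q))) (λ _ _ → ℕP.*-cancelˡ-≡ _ _ p))
    (λ (x∈l , x∈r) → let (y , _ , x≡py) = ∈-map⁻ (p ℕ.*_) x∈r in
      p∤q (ℕD.∣-trans (P.subst (p ∣_) (P.sym x≡py) (ℕD.m∣m*n y)) (∈-divisors⁻ x∈l)))
  sub : divisors (p ℕ.* q) ⊆ divisors q ++ map (p ℕ.*_) (divisors q)
  sub {d} d∈ with prime-∣⊎coprime d p-prime
  ... | inj₁ (divides k P.refl) = ∈-++⁺ʳ (divisors q) (P.subst (_∈ map (p ℕ.*_) (divisors q)) (ℕP.*-comm p k) (∈-map⁺ (p ℕ.*_) (∈-divisors⁺ k∣q)))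
    where
    k∣q : k ∣ q
    k∣q = ℕD.*-cancelˡ-∣ p (P.subst (_∣ p ℕ.* q) (ℕP.*-comm k p) (∈-divisors⁻ d∈))
  ... | inj₂ p⊥d = ∈-++⁺ˡ (∈-divisors⁺ (Coprime.coprime-divisor (Coprime.sym p⊥d) (∈-divisors⁻ d∈)))
  sup : divisors q ++ map (p ℕ.*_) (divisors q) ⊆ divisors (p ℕ.* q)
  sup d∈ with ∈-++⁻ (divisors q) d∈
  ... | inj₁ d∈l = ∈-divisors⁺ (ℕD.∣n⇒∣m*n p (∈-divisors⁻ d∈l))
  ... | inj₂ d∈r with ∈-map⁻ (p ℕ.*_) d∈r
  ...   | y , y∈ , P.refl = ∈-divisors⁺ (ℕD.*-monoʳ-∣ p (∈-divisors⁻ y∈))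

-- Truncated division, n ÷ 0 = 0, for use where no NonZero instance is available.
_÷_ : ℕ → ℕ → ℕ
n ÷ zero = 0
n ÷ suc d = n / suc d

÷≡/ : ∀ n d .{{_ : NonZero d}} → n ÷ d ≡ n / d
÷≡/ n (suc d) = P.refl

module RingProperties (K : CommutativeRing 0ℓ 0ℓ) where

  open CommutativeRing K
  open RingOps K
  open import Algebra.Properties.Ring ring using (-‿distribʳ-*; -‿distribˡ-*; -‿involutive; -0#≈0#; -‿+-comm)
  open import Relation.Binary.Reasoning.Setoid setoid
  open import Algebra.Properties.CommutativeSemigroup *-commutativeSemigroup public
    using () renaming (interchange to *-interchange)
  open import Algebra.Properties.CommutativeSemigroup +-commutativeSemigroup
    using () renaming (interchange to +-interchange)

  fromℕ-+ : ∀ m n → fromℕ (m ℕ.+ n) ≈ fromℕ m + fromℕ n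
  fromℕ-+ zero n = sym (+-identityˡ _)
  fromℕ-+ (suc m) n = trans (+-congˡ (fromℕ-+ m n)) (sym (+-assoc _ _ _))

  fromℕ-* : ∀ m n → fromℕ (m ℕ.* n) ≈ fromℕ m * fromℕ n
  fromℕ-* zero n = sym (zeroˡ _)
  fromℕ-* (suc m) n = begin
    fromℕ (n ℕ.+ m ℕ.* n)             ≈⟨ fromℕ-+ n (m ℕ.* n) ⟩
    fromℕ n + fromℕ (m ℕ.* n)         ≈⟨ +-cong (sym (*-identityˡ _)) (fromℕ-* m n) ⟩
    1# * fromℕ n + fromℕ m * fromℕ n  ≈⟨ distribʳ _ _ _ ⟨
    (1# + fromℕ m) * fromℕ n          ∎

  fromℕ-∸ : ∀ {m n} → n ℕ.≤ m → fromℕ (m ℕ.∸ n) ≈ fromℕ m - fromℕ n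
  fromℕ-∸ {m} {n} n≤m = begin
    fromℕ (m ℕ.∸ n)                          ≈⟨ +-identityʳ _ ⟨
    fromℕ (m ℕ.∸ n) + 0#                     ≈⟨ +-congˡ (-‿inverseʳ _) ⟨
    fromℕ (m ℕ.∸ n) + (fromℕ n - fromℕ n)    ≈⟨ +-assoc _ _ _ ⟨
    (fromℕ (m ℕ.∸ n) + fromℕ n) - fromℕ n    ≈⟨ +-congʳ (fromℕ-+ (m ℕ.∸ n) n) ⟨
    fromℕ (m ℕ.∸ n ℕ.+ n) - fromℕ n          ≡⟨ P.cong (λ k → fromℕ k - fromℕ n) (ℕP.m∸n+n≡m n≤m) ⟩
    fromℕ m - fromℕ n                        ∎

  fromℤ-neg : ∀ i → fromℤ (ℤ.- i) ≈ - fromℤ i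
  fromℤ-neg (+ zero) = sym -0#≈0#
  fromℤ-neg (+ suc n) = refl
  fromℤ-neg -[1+ n ] = sym (-‿involutive _)

  private
    x-y≈[a+x]-[a+y] : ∀ a x y → x - y ≈ (a + x) - (a + y)
    x-y≈[a+x]-[a+y] a x y = begin
      x - y                ≈⟨ +-identityˡ _ ⟨
      0# + (x - y)         ≈⟨ +-congʳ (-‿inverseʳ a) ⟨
      (a - a) + (x - y)    ≈⟨ +-assoc _ _ _ ⟩
      a + (- a + (x - y))  ≈⟨ +-congˡ (+-assoc _ _ _) ⟨
      a + ((- a + x) - y)  ≈⟨ +-congˡ (+-congʳ (+-comm _ _)) ⟩
      a + ((x - a) - y)    ≈⟨ +-congˡ (+-assoc _ _ _) ⟩
      a + (x + (- a - y))  ≈⟨ +-congˡ (+-congˡ (-‿+-comm a y)) ⟩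
      a + (x - (a + y))    ≈⟨ +-assoc _ _ _ ⟨
      (a + x) - (a + y)    ∎

  fromℤ-⊖ : ∀ m n → fromℤ (m ℤ.⊖ n) ≈ fromℕ m - fromℕ n
  fromℤ-⊖ zero zero = sym (-‿inverseʳ 0#)
  fromℤ-⊖ zero (suc n) = sym (+-identityˡ _)
  fromℤ-⊖ (suc m) zero = sym (trans (+-congˡ -0#≈0#) (+-identityʳ _))
  fromℤ-⊖ (suc m) (suc n) = begin
    fromℤ (suc m ℤ.⊖ suc n)          ≡⟨ P.cong fromℤ (ℤP.[1+m]⊖[1+n]≡m⊖n m n) ⟩
    fromℤ (m ℤ.⊖ n)                  ≈⟨ fromℤ-⊖ m n ⟩
    fromℕ m - fromℕ n                ≈⟨ x-y≈[a+x]-[a+y] 1# _ _ ⟩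
    (1# + fromℕ m) - (1# + fromℕ n)  ∎

  fromℤ-+ : ∀ i j → fromℤ (i ℤ.+ j) ≈ fromℤ i + fromℤ j
  fromℤ-+ (+ m) (+ n) = fromℕ-+ m n
  fromℤ-+ (+ m) -[1+ n ] = fromℤ-⊖ m (suc n)
  fromℤ-+ -[1+ m ] (+ n) = trans (fromℤ-⊖ n (suc m)) (+-comm _ _)
  fromℤ-+ -[1+ m ] -[1+ n ] = begin
    - fromℕ (suc (suc (m ℕ.+ n)))      ≡⟨ P.cong (λ z → - fromℕ z) (ℕP.+-suc (suc m) n) ⟨
    - fromℕ (suc m ℕ.+ suc n)          ≈⟨ -‿cong (fromℕ-+ (suc m) (suc n)) ⟩
    - (fromℕ (suc m) + fromℕ (suc n))  ≈⟨ -‿+-comm _ _ ⟨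
    - fromℕ (suc m) - fromℕ (suc n)    ∎

  fromℤ-* : ∀ i j → fromℤ (i ℤ.* j) ≈ fromℤ i * fromℤ j
  fromℤ-* (+ m) (+ n) = trans (reflexive (P.cong fromℤ (ℤP.+◃n≡+n (m ℕ.* n)))) (fromℕ-* m n)
  fromℤ-* (+ m) -[1+ n ] = begin
    fromℤ (Sign.- ℤ.◃ (m ℕ.* suc n))  ≡⟨ P.cong fromℤ (ℤP.-◃n≡-n (m ℕ.* suc n)) ⟩
    fromℤ (ℤ.- (+ (m ℕ.* suc n)))     ≈⟨ fromℤ-neg (+ (m ℕ.* suc n)) ⟩
    - fromℕ (m ℕ.* suc n)             ≈⟨ -‿cong (fromℕ-* m (suc n)) ⟩
    - (fromℕ m * fromℕ (suc n))       ≈⟨ -‿distribʳ-* _ _ ⟩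
    fromℕ m * - fromℕ (suc n)         ∎
  fromℤ-* -[1+ m ] (+ n) = begin
    fromℤ (Sign.- ℤ.◃ (suc m ℕ.* n))  ≡⟨ P.cong fromℤ (ℤP.-◃n≡-n (suc m ℕ.* n)) ⟩
    fromℤ (ℤ.- (+ (suc m ℕ.* n)))     ≈⟨ fromℤ-neg (+ (suc m ℕ.* n)) ⟩
    - fromℕ (suc m ℕ.* n)             ≈⟨ -‿cong (fromℕ-* (suc m) n) ⟩
    - (fromℕ (suc m) * fromℕ n)       ≈⟨ -‿distribˡ-* _ _ ⟩
    - fromℕ (suc m) * fromℕ n         ∎
  fromℤ-* -[1+ m ] -[1+ n ] = begin
    fromℕ (suc m ℕ.* suc n)               ≈⟨ fromℕ-* (suc m) (suc n) ⟩
    fromℕ (suc m) * fromℕ (suc n)         ≈⟨ *-congʳ (-‿involutive _) ⟨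
    - - fromℕ (suc m) * fromℕ (suc n)     ≈⟨ -‿distribˡ-* _ _ ⟨
    - (- fromℕ (suc m) * fromℕ (suc n))   ≈⟨ -‿distribʳ-* _ _ ⟩
    - fromℕ (suc m) * - fromℕ (suc n)     ∎

  -- Integer coefficients let the ring solver cancel signs, as in (- x) * (- x) = x * x.
  private
    ℤ-rawRing : RawRing 0ℓ 0ℓ
    ℤ-rawRing = record { Carrier = ℤ ; _≈_ = _≡_ ; _+_ = ℤ._+_ ; _*_ = ℤ._*_ ; -_ = ℤ.-_ ; 0# = + 0 ; 1# = + 1 }

    fromℤ-homomorphism : ℤ-rawRing -Raw-AlmostCommutative⟶ fromCommutativeRing K
    fromℤ-homomorphism = record
      { ⟦_⟧ = fromℤ ; +-homo = fromℤ-+ ; *-homo = fromℤ-* ; -‿homo = fromℤ-neg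
      ; 0-homo = refl ; 1-homo = +-identityʳ _ }

  open RingSolver ℤ-rawRing (fromCommutativeRing K) fromℤ-homomorphism
    (λ i j → Maybe.map (reflexive ∘ P.cong fromℤ) (dec⇒maybe (i ℤ.≟ j)))
    public using (solve; _:+_; _:*_; _:-_; :-_; _:=_)

  x-1≈0⇒x≈1 : ∀ {x} → x - 1# ≈ 0# → x ≈ 1#
  x-1≈0⇒x≈1 {x} x-1≈0 = begin
    x                 ≈⟨ +-identityʳ x ⟨
    x + 0#            ≈⟨ +-congˡ (-‿inverseˡ 1#) ⟨
    x + (- 1# + 1#)   ≈⟨ +-assoc _ _ _ ⟨
    (x - 1#) + 1#     ≈⟨ +-congʳ x-1≈0 ⟩
    0# + 1#           ≈⟨ +-identityˡ _ ⟩
    1#                ∎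

  ∑ : {A : Set} → (A → Carrier) → List A → Carrier
  ∑ f xs = foldr _+_ 0# (map f xs)

  𝟙 : {A : Set} → Dec A → Carrier
  𝟙 (yes _) = 1#
  𝟙 (no _) = 0#

  private variable
    A B : Set

  ∑-cong-∈ : {f g : A → Carrier} (xs : List A) → (∀ {x} → x ∈ xs → f x ≈ g x) → ∑ f xs ≈ ∑ g xs
  ∑-cong-∈ [] _ = refl
  ∑-cong-∈ (x ∷ xs) f≈g = +-cong (f≈g (here P.refl)) (∑-cong-∈ xs (f≈g ∘ there))

  ∑-cong : {f g : A → Carrier} (xs : List A) → (∀ x → f x ≈ g x) → ∑ f xs ≈ ∑ g xs
  ∑-cong xs f≈g = ∑-cong-∈ xs (λ {x} _ → f≈g x)

  ∑-++ : (f : A → Carrier) (xs ys : List A) → ∑ f (xs ++ ys) ≈ ∑ f xs + ∑ f ys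
  ∑-++ f [] ys = sym (+-identityˡ _)
  ∑-++ f (x ∷ xs) ys = trans (+-congˡ (∑-++ f xs ys)) (sym (+-assoc _ _ _))

  ∑-map : (f : B → Carrier) (g : A → B) (xs : List A) → ∑ f (map g xs) ≡ ∑ (f ∘ g) xs
  ∑-map f g xs = P.cong (foldr _+_ 0#) (P.sym (List.map-∘ xs))

  ∑-0 : (xs : List A) → ∑ (λ _ → 0#) xs ≈ 0#
  ∑-0 [] = refl
  ∑-0 (x ∷ xs) = trans (+-congˡ (∑-0 xs)) (+-identityʳ _)

  ∑-+ : (f g : A → Carrier) (xs : List A) → ∑ (λ x → f x + g x) xs ≈ ∑ f xs + ∑ g xs
  ∑-+ f g [] = sym (+-identityʳ _)
  ∑-+ f g (x ∷ xs) = trans (+-congˡ (∑-+ f g xs)) (+-interchange _ _ _ _)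

  ∑-*ˡ : (c : Carrier) (f : A → Carrier) (xs : List A) → c * ∑ f xs ≈ ∑ (λ x → c * f x) xs
  ∑-*ˡ c f [] = zeroʳ _
  ∑-*ˡ c f (x ∷ xs) = trans (distribˡ _ _ _) (+-congˡ (∑-*ˡ c f xs))

  ∑-*ʳ : (c : Carrier) (f : A → Carrier) (xs : List A) → ∑ f xs * c ≈ ∑ (λ x → f x * c) xs
  ∑-*ʳ c f xs = trans (*-comm _ _) (trans (∑-*ˡ c f xs) (∑-cong xs (λ _ → *-comm _ _)))

  ∑-neg : (f : A → Carrier) (xs : List A) → ∑ (λ x → - f x) xs ≈ - ∑ f xs
  ∑-neg f [] = sym -0#≈0#
  ∑-neg f (x ∷ xs) = trans (+-congˡ (∑-neg f xs)) (-‿+-comm _ _)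

  ∑-comm : (f : A → B → Carrier) (xs : List A) (ys : List B) →
           ∑ (λ x → ∑ (f x) ys) xs ≈ ∑ (λ y → ∑ (λ x → f x y) xs) ys
  ∑-comm f [] ys = sym (∑-0 ys)
  ∑-comm f (x ∷ xs) ys = begin
    ∑ (f x) ys + ∑ (λ x → ∑ (f x) ys) xs           ≈⟨ +-congˡ (∑-comm f xs ys) ⟩
    ∑ (f x) ys + ∑ (λ y → ∑ (λ x → f x y) xs) ys   ≈⟨ ∑-+ (f x) (λ y → ∑ (λ x → f x y) xs) ys ⟨
    ∑ (λ y → f x y + ∑ (λ x → f x y) xs) ys        ∎

  ∑-↭ : (f : A → Carrier) {xs ys : List A} → xs ↭ ys → ∑ f xs ≈ ∑ f ys
  ∑-↭ f xs↭ys = PermSetoid.foldr-commMonoid setoid +-isCommutativeMonoid (↭⇒↭ₛ′ isEquivalence (Perm.map⁺ f xs↭ys))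

  ∑-filter : {Q : A → Set} (Q? : Decidable Q) (f : A → Carrier) (xs : List A) →
             ∑ f (filter Q? xs) ≈ ∑ (λ x → 𝟙 (Q? x) * f x) xs
  ∑-filter Q? f [] = refl
  ∑-filter Q? f (x ∷ xs) with Q? x
  ... | yes _ = +-cong (sym (*-identityˡ _)) (∑-filter Q? f xs)
  ... | no _ = trans (∑-filter Q? f xs) (sym (trans (+-congʳ (zeroˡ _)) (+-identityˡ _)))

  ∑-1 : (xs : List A) → ∑ (λ _ → 1#) xs ≈ fromℕ (length xs)
  ∑-1 [] = refl
  ∑-1 (x ∷ xs) = +-congˡ (∑-1 xs)

  fromℕ-length-filter : {Q : A → Set} (Q? : Decidable Q) (xs : List A) →
                        fromℕ (length (filter Q? xs)) ≈ ∑ (λ x → 𝟙 (Q? x)) xs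
  fromℕ-length-filter Q? xs = begin
    fromℕ (length (filter Q? xs))        ≈⟨ ∑-1 (filter Q? xs) ⟨
    ∑ (λ _ → 1#) (filter Q? xs)          ≈⟨ ∑-filter Q? (λ _ → 1#) xs ⟩
    ∑ (λ x → 𝟙 (Q? x) * 1#) xs           ≈⟨ ∑-cong xs (λ _ → *-identityʳ _) ⟩
    ∑ (λ x → 𝟙 (Q? x)) xs                ∎

  𝟙≈1 : (d : Dec A) → A → 𝟙 d ≈ 1#
  𝟙≈1 (yes _) _ = refl
  𝟙≈1 (no ¬a) a = contradiction a ¬a

  𝟙≈0 : (d : Dec A) → ¬ A → 𝟙 d ≈ 0#
  𝟙≈0 (yes a) ¬a = contradiction a ¬a
  𝟙≈0 (no _) _ = refl

  𝟙-¬ : (d : Dec A) (e : Dec (¬ A)) → 𝟙 e ≈ 1# - 𝟙 d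
  𝟙-¬ (yes a) e = trans (𝟙≈0 e (λ ¬a → ¬a a)) (sym (-‿inverseʳ _))
  𝟙-¬ (no ¬a) e = trans (𝟙≈1 e ¬a) (sym (trans (+-congˡ -0#≈0#) (+-identityʳ _)))

  𝟙-⇔ : (d : Dec A) (e : Dec B) → (A → B) → (B → A) → 𝟙 d ≈ 𝟙 e
  𝟙-⇔ (yes a) e to _ = sym (𝟙≈1 e (to a))
  𝟙-⇔ (no ¬a) e _ from = sym (𝟙≈0 e (¬a ∘ from))

  𝟙-× : (d : Dec A) (e : Dec B) (d×e : Dec (A × B)) → 𝟙 d×e ≈ 𝟙 d * 𝟙 e
  𝟙-× (yes a) (yes b) d×e = trans (𝟙≈1 d×e (a , b)) (sym (*-identityˡ _))
  𝟙-× (yes a) (no ¬b) d×e = trans (𝟙≈0 d×e (¬b ∘ proj₂)) (sym (zeroʳ _))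
  𝟙-× (no ¬a) e d×e = trans (𝟙≈0 d×e (¬a ∘ proj₁)) (sym (zeroˡ _))

  ∑-cartesianProduct : (h : A × B → Carrier) (xs : List A) (ys : List B) →
                       ∑ h (cartesianProduct xs ys) ≈ ∑ (λ x → ∑ (λ y → h (x , y)) ys) xs
  ∑-cartesianProduct h [] ys = refl
  ∑-cartesianProduct h (x ∷ xs) ys = begin
    ∑ h (map (x ,_) ys ++ cartesianProduct xs ys)        ≈⟨ ∑-++ h (map (x ,_) ys) _ ⟩
    ∑ h (map (x ,_) ys) + ∑ h (cartesianProduct xs ys)   ≈⟨ +-cong (reflexive (∑-map h (x ,_) ys)) (∑-cartesianProduct h xs ys) ⟩
    ∑ (λ y → h (x , y)) ys + ∑ (λ x → ∑ (λ y → h (x , y)) ys) xs ∎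

  ∑-*-∑ : (f : A → Carrier) (g : B → Carrier) (xs : List A) (ys : List B) →
          ∑ (λ x → ∑ (λ y → f x * g y) ys) xs ≈ ∑ f xs * ∑ g ys
  ∑-*-∑ f g xs ys = begin
    ∑ (λ x → ∑ (λ y → f x * g y) ys) xs  ≈⟨ ∑-cong xs (λ x → ∑-*ˡ (f x) g ys) ⟨
    ∑ (λ x → f x * ∑ g ys) xs            ≈⟨ ∑-*ʳ (∑ g ys) f xs ⟨
    ∑ f xs * ∑ g ys                      ∎

  ∑-upTo-cong : {f g : ℕ → Carrier} (q : ℕ) → (∀ x → x ℕ.< q → f x ≈ g x) → ∑ f (upTo q) ≈ ∑ g (upTo q)
  ∑-upTo-cong q f≈g = ∑-cong-∈ (upTo q) (λ {x} x∈ → f≈g x (∈-upTo⁻ x∈))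

  ∑-upTo-suc : (f : ℕ → Carrier) (n : ℕ) → ∑ f (upTo (suc n)) ≈ ∑ f (upTo n) + f n
  ∑-upTo-suc f n = begin
    ∑ f (upTo (suc n))           ≡⟨ P.cong (∑ f) (List.upTo-∷ʳ n) ⟨
    ∑ f (upTo n ++ n ∷ [])       ≈⟨ ∑-++ f (upTo n) (n ∷ []) ⟩
    ∑ f (upTo n) + (f n + 0#)    ≈⟨ +-congˡ (+-identityʳ _) ⟩
    ∑ f (upTo n) + f n           ∎

  ∑-upTo-suc-shift : (f : ℕ → Carrier) (n : ℕ) → ∑ f (upTo (suc n)) ≈ f 0 + ∑ (f ∘ suc) (upTo n)
  ∑-upTo-suc-shift f n = +-congˡ (reflexive (P.cong (foldr _+_ 0#)
    (P.trans (List.map-applyUpTo suc f n) (P.sym (List.map-upTo (f ∘ suc) n)))))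

  ∑-upTo-vanishing : (f : ℕ → Carrier) (k : ℕ) → (∀ i → k ℕ.≤ i → f i ≈ 0#) → ∀ {n} → k ℕ.≤ n →
    ∑ f (upTo n) ≈ ∑ f (upTo k)
  ∑-upTo-vanishing f k f≈0 {n} k≤n = begin
    ∑ f (upTo n)                    ≡⟨ P.cong (∑ f ∘ upTo) (ℕP.m+[n∸m]≡n k≤n) ⟨
    ∑ f (upTo (k ℕ.+ (n ℕ.∸ k)))    ≈⟨ extend (n ℕ.∸ k) ⟩
    ∑ f (upTo k)                    ∎
    where
    extend : ∀ m → ∑ f (upTo (k ℕ.+ m)) ≈ ∑ f (upTo k)
    extend zero = reflexive (P.cong (∑ f ∘ upTo) (ℕP.+-identityʳ k))
    extend (suc m) = begin
      ∑ f (upTo (k ℕ.+ suc m))               ≡⟨ P.cong (∑ f ∘ upTo) (ℕP.+-suc k m) ⟩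
      ∑ f (upTo (suc (k ℕ.+ m)))             ≈⟨ ∑-upTo-suc f (k ℕ.+ m) ⟩
      ∑ f (upTo (k ℕ.+ m)) + f (k ℕ.+ m)     ≈⟨ +-cong (extend m) (f≈0 _ (ℕP.m≤m+n k m)) ⟩
      ∑ f (upTo k) + 0#                      ≈⟨ +-identityʳ _ ⟩
      ∑ f (upTo k)                           ∎

  ∑-δ : (r q : ℕ) → r ℕ.< q → (f : ℕ → Carrier) → ∑ (λ m → 𝟙 (m ℕ.≟ r) * f m) (upTo q) ≈ f r
  ∑-δ r q r<q f = begin
    ∑ g (upTo q)             ≈⟨ ∑-upTo-vanishing g (suc r) (λ i r<i → g≈0 (λ i≡r → ℕP.<-irrefl (P.sym i≡r) r<i)) r<q ⟩
    ∑ g (upTo (suc r))       ≈⟨ ∑-upTo-suc g r ⟩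
    ∑ g (upTo r) + g r       ≈⟨ +-cong (trans (∑-upTo-cong r (λ x x<r → g≈0 (λ x≡r → ℕP.<-irrefl x≡r x<r))) (∑-0 (upTo r)))
                                       (trans (*-congʳ (𝟙≈1 (r ℕ.≟ r) P.refl)) (*-identityˡ _)) ⟩
    0# + f r                 ≈⟨ +-identityˡ _ ⟩
    f r                      ∎
    where
    g = λ m → 𝟙 (m ℕ.≟ r) * f m
    g≈0 : ∀ {i} → i ≢ r → g i ≈ 0#
    g≈0 {i} i≢r = trans (*-congʳ (𝟙≈0 (i ℕ.≟ r) i≢r)) (zeroˡ _)

  pow-+ : ∀ x m n → pow x (m ℕ.+ n) ≈ pow x m * pow x n
  pow-+ x zero n = sym (*-identityˡ _)
  pow-+ x (suc m) n = trans (*-congˡ (pow-+ x m n)) (sym (*-assoc _ _ _))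

  pow-cong : ∀ {x y} n → x ≈ y → pow x n ≈ pow y n
  pow-cong zero _ = refl
  pow-cong (suc n) x≈y = *-cong x≈y (pow-cong n x≈y)

  pow-1# : ∀ n → pow 1# n ≈ 1#
  pow-1# zero = refl
  pow-1# (suc n) = trans (*-identityˡ _) (pow-1# n)

  pow-* : ∀ x m n → pow x (m ℕ.* n) ≈ pow (pow x m) n
  pow-* x m zero = reflexive (P.cong (pow x) (ℕP.*-zeroʳ m))
  pow-* x m (suc n) = begin
    pow x (m ℕ.* suc n)           ≡⟨ P.cong (pow x) (ℕP.*-suc m n) ⟩
    pow x (m ℕ.+ m ℕ.* n)         ≈⟨ pow-+ x m (m ℕ.* n) ⟩
    pow x m * pow x (m ℕ.* n)     ≈⟨ *-congˡ (pow-* x m n) ⟩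
    pow x m * pow (pow x m) n     ∎

  [x-1]*∑pow≈pow-1 : ∀ x p → (x - 1#) * ∑ (pow x) (upTo p) ≈ pow x p - 1#
  [x-1]*∑pow≈pow-1 x zero = trans (zeroʳ _) (sym (-‿inverseʳ 1#))
  [x-1]*∑pow≈pow-1 x (suc p) = begin
    (x - 1#) * ∑ (pow x) (upTo (suc p))                   ≈⟨ *-congˡ (∑-upTo-suc (pow x) p) ⟩
    (x - 1#) * (∑ (pow x) (upTo p) + pow x p)             ≈⟨ distribˡ _ _ _ ⟩
    (x - 1#) * ∑ (pow x) (upTo p) + (x - 1#) * pow x p    ≈⟨ +-congʳ ([x-1]*∑pow≈pow-1 x p) ⟩
    (pow x p - 1#) + (x - 1#) * pow x p                   ≈⟨ +-congˡ (trans (distribʳ _ _ _) (+-congˡ (trans (sym (-‿distribˡ-* _ _)) (-‿cong (*-identityˡ _))))) ⟩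
    (pow x p - 1#) + (x * pow x p - pow x p)              ≈⟨ solve 3 (λ x t o → (t :- o) :+ (x :* t :- t) := x :* t :- o) refl x (pow x p) 1# ⟩
    x * pow x p - 1#                                      ∎

  module _ (d e : ℕ) .{{_ : NonZero d}} .{{_ : NonZero e}} (d⊥e : Coprime d e) where

    ∑-crt-split : (f g : ℕ → Carrier) →
      ∑ (λ m → f (m % d) * g (m % e)) (upTo (d ℕ.* e)) ≈ ∑ f (upTo d) * ∑ g (upTo e)
    ∑-crt-split f g = begin
      ∑ (λ m → f (m % d) * g (m % e)) (upTo (d ℕ.* e))            ≡⟨ ∑-map f×g (λ m → (m % d , m % e)) (upTo (d ℕ.* e)) ⟨
      ∑ f×g (map (λ m → (m % d , m % e)) (upTo (d ℕ.* e)))         ≈⟨ ∑-↭ f×g (crt-split-↭ d e d⊥e) ⟩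
      ∑ f×g (cartesianProduct (upTo d) (upTo e))                   ≈⟨ ∑-cartesianProduct f×g (upTo d) (upTo e) ⟩
      ∑ (λ x → ∑ (λ y → f x * g y) (upTo e)) (upTo d)              ≈⟨ ∑-*-∑ f g (upTo d) (upTo e) ⟩
      ∑ f (upTo d) * ∑ g (upTo e)                                  ∎
      where
      f×g : ℕ × ℕ → Carrier
      f×g (x , y) = f x * g y

    ∑-crt-join : (f : ℕ → Carrier) →
      ∑ f (upTo (d ℕ.* e)) ≈ ∑ (λ x → ∑ (λ y → f (crt-join d e (x , y))) (upTo e)) (upTo d)
    ∑-crt-join f = begin
      ∑ f (upTo (d ℕ.* e))                                         ≈⟨ ∑-↭ f (crt-join-↭ d e d⊥e) ⟨
      ∑ f (map (crt-join d e) (cartesianProduct (upTo d) (upTo e))) ≡⟨ ∑-map f (crt-join d e) (cartesianProduct (upTo d) (upTo e)) ⟩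
      ∑ (f ∘ crt-join d e) (cartesianProduct (upTo d) (upTo e))     ≈⟨ ∑-cartesianProduct (f ∘ crt-join d e) (upTo d) (upTo e) ⟩
      ∑ (λ x → ∑ (λ y → f (crt-join d e (x , y))) (upTo e)) (upTo d) ∎

  ∑-multiples : ∀ d .{{_ : NonZero d}} (g : ℕ → Carrier) R →
    ∑ (λ k → 𝟙 (d ∣? suc k) * g (suc k / d)) (upTo R) ≈ ∑ (g ∘ suc) (upTo (R / d))
  ∑-multiples d g zero = reflexive (P.cong (∑ (g ∘ suc) ∘ upTo) (P.sym (0/n≡0 d)))
  ∑-multiples d g (suc R) with d ∣? suc R in eq
  ... | yes d∣1+R = begin
    ∑ f (upTo (suc R))                          ≈⟨ ∑-upTo-suc f R ⟩
    ∑ f (upTo R) + 𝟙 (d ∣? suc R) * g (suc R / d) ≈⟨ +-cong (∑-multiples d g R) (*-congʳ (reflexive (P.cong 𝟙 eq))) ⟩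
    ∑ (g ∘ suc) (upTo (R / d)) + 1# * g (suc R / d) ≈⟨ +-congˡ (trans (*-identityˡ _) (reflexive (P.cong g ([1+n]/d≡1+n/d d∣1+R)))) ⟩
    ∑ (g ∘ suc) (upTo (R / d)) + g (suc (R / d)) ≈⟨ ∑-upTo-suc (g ∘ suc) (R / d) ⟨
    ∑ (g ∘ suc) (upTo (suc (R / d)))            ≡⟨ P.cong (∑ (g ∘ suc) ∘ upTo) ([1+n]/d≡1+n/d d∣1+R) ⟨
    ∑ (g ∘ suc) (upTo (suc R / d))              ∎
    where f = λ k → 𝟙 (d ∣? suc k) * g (suc k / d)
  ... | no d∤1+R = begin
    ∑ f (upTo (suc R))                          ≈⟨ ∑-upTo-suc f R ⟩
    ∑ f (upTo R) + 𝟙 (d ∣? suc R) * g (suc R / d) ≈⟨ +-cong (∑-multiples d g R) (*-congʳ (reflexive (P.cong 𝟙 eq))) ⟩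
    ∑ (g ∘ suc) (upTo (R / d)) + 0# * g (suc R / d) ≈⟨ trans (+-congˡ (zeroˡ _)) (+-identityʳ _) ⟩
    ∑ (g ∘ suc) (upTo (R / d))                  ≡⟨ P.cong (∑ (g ∘ suc) ∘ upTo) ([1+n]/d≡n/d d∤1+R) ⟨
    ∑ (g ∘ suc) (upTo (suc R / d))              ∎
    where f = λ k → 𝟙 (d ∣? suc k) * g (suc k / d)

module CyclotomicField {N : ℕ} (C : CycloField N) .{{_ : NonZero N}} where

  open CycloField C
  open RingProperties K
  open import Relation.Binary.Reasoning.Setoid setoid

  1#≉0# : 1# ≉ 0#
  1#≉0# 1≈0 = charZero 0 (trans (+-identityʳ 1#) 1≈0)

  fromℕ≉0# : ∀ k .{{_ : NonZero k}} → fromℕ k ≉ 0#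
  fromℕ≉0# (suc k) = charZero k

  inverseˡ : ∀ {x} → x ≉ 0# → x ⁻¹ * x ≈ 1#
  inverseˡ x≉0 = trans (*-comm _ _) (inverse _ x≉0)

  *-cancelˡ-≈0 : ∀ {x y} → x ≉ 0# → x * y ≈ 0# → y ≈ 0#
  *-cancelˡ-≈0 {x} {y} x≉0 xy≈0 = begin
    y               ≈⟨ *-identityˡ y ⟨
    1# * y          ≈⟨ *-congʳ (inverseˡ x≉0) ⟨
    (x ⁻¹ * x) * y  ≈⟨ *-assoc _ _ _ ⟩
    x ⁻¹ * (x * y)  ≈⟨ *-congˡ xy≈0 ⟩
    x ⁻¹ * 0#       ≈⟨ zeroʳ _ ⟩
    0#              ∎

  *-≉0 : ∀ {x y} → x ≉ 0# → y ≉ 0# → x * y ≉ 0#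
  *-≉0 x≉0 y≉0 xy≈0 = y≉0 (*-cancelˡ-≈0 x≉0 xy≈0)

  ⁻¹-≉0 : ∀ {x} → x ≉ 0# → x ⁻¹ ≉ 0#
  ⁻¹-≉0 x≉0 x⁻¹≈0 = 1#≉0# (trans (sym (inverse _ x≉0)) (trans (*-congˡ x⁻¹≈0) (zeroʳ _)))

  ⁻¹-unique : ∀ {x y} → x ≉ 0# → x * y ≈ 1# → y ≈ x ⁻¹
  ⁻¹-unique {x} {y} x≉0 xy≈1 = begin
    y               ≈⟨ *-identityˡ y ⟨
    1# * y          ≈⟨ *-congʳ (inverseˡ x≉0) ⟨
    (x ⁻¹ * x) * y  ≈⟨ *-assoc _ _ _ ⟩
    x ⁻¹ * (x * y)  ≈⟨ *-congˡ xy≈1 ⟩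
    x ⁻¹ * 1#       ≈⟨ *-identityʳ _ ⟩
    x ⁻¹            ∎

  ⁻¹-cong : ∀ {x y} → x ≉ 0# → x ≈ y → x ⁻¹ ≈ y ⁻¹
  ⁻¹-cong x≉0 x≈y = ⁻¹-unique (λ y≈0 → x≉0 (trans x≈y y≈0)) (trans (*-congʳ (sym x≈y)) (inverse _ x≉0))

  ⁻¹-* : ∀ {x y} → x ≉ 0# → y ≉ 0# → (x * y) ⁻¹ ≈ x ⁻¹ * y ⁻¹
  ⁻¹-* {x} {y} x≉0 y≉0 = sym (⁻¹-unique (*-≉0 x≉0 y≉0) (begin
    (x * y) * (x ⁻¹ * y ⁻¹)    ≈⟨ *-interchange x y (x ⁻¹) (y ⁻¹) ⟩
    (x * x ⁻¹) * (y * y ⁻¹)    ≈⟨ *-cong (inverse _ x≉0) (inverse _ y≉0) ⟩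
    1# * 1#                    ≈⟨ *-identityˡ _ ⟩
    1#                         ∎))

  ⁻¹-involutive : ∀ {x} → x ≉ 0# → x ⁻¹ ⁻¹ ≈ x
  ⁻¹-involutive x≉0 = sym (⁻¹-unique (⁻¹-≉0 x≉0) (inverseˡ x≉0))

  1#⁻¹≈1# : 1# ⁻¹ ≈ 1#
  1#⁻¹≈1# = sym (⁻¹-unique 1#≉0# (*-identityˡ _))

  ∑pow≈0 : ∀ x p → x ≉ 1# → pow x p ≈ 1# → ∑ (pow x) (upTo p) ≈ 0#
  ∑pow≈0 x p x≉1 xᵖ≈1 = *-cancelˡ-≈0 (x≉1 ∘ x-1≈0⇒x≈1) (trans ([x-1]*∑pow≈pow-1 x p) (trans (+-congʳ xᵖ≈1) (-‿inverseʳ 1#)))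

  ζ^ : ℤ → Carrier
  ζ^ k = pow ζ (k %ℕ N)

  ζ^-pos : ∀ m → ζ^ (+ m) ≈ pow ζ m
  ζ^-pos m = begin
    pow ζ (m % N)                                ≈⟨ *-identityʳ _ ⟨
    pow ζ (m % N) * 1#                           ≈⟨ *-congˡ ζ^[kN]≈1 ⟨
    pow ζ (m % N) * pow ζ ((m / N) ℕ.* N)        ≈⟨ pow-+ ζ (m % N) ((m / N) ℕ.* N) ⟨
    pow ζ (m % N ℕ.+ (m / N) ℕ.* N)              ≡⟨ P.cong (pow ζ) (ℕM.m≡m%n+[m/n]*n m N) ⟨
    pow ζ m                                      ∎
    where
    ζ^[kN]≈1 : pow ζ ((m / N) ℕ.* N) ≈ 1#
    ζ^[kN]≈1 = begin
      pow ζ ((m / N) ℕ.* N)      ≡⟨ P.cong (pow ζ) (ℕP.*-comm (m / N) N) ⟩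
      pow ζ (N ℕ.* (m / N))      ≈⟨ pow-* ζ N (m / N) ⟩
      pow (pow ζ N) (m / N)      ≈⟨ pow-cong (m / N) ζ-root ⟩
      pow 1# (m / N)             ≈⟨ pow-1# (m / N) ⟩
      1#                         ∎

  ζ^-cong : ∀ {a b} → a ≡ b mod N → ζ^ a ≡ ζ^ b
  ζ^-cong a≡b = P.cong (pow ζ) (≡mod⇒%ℕ≡ a≡b)

  ζ^-+ : ∀ a b → ζ^ (a ℤ.+ b) ≈ ζ^ a * ζ^ b
  ζ^-+ a b = begin
    ζ^ (a ℤ.+ b)                           ≡⟨ ζ^-cong (mod-+ (≡-%ℕ a N) (≡-%ℕ b N)) ⟩
    ζ^ (+ (a %ℕ N) ℤ.+ + (b %ℕ N))         ≡⟨ P.cong ζ^ (ℤP.pos-+ (a %ℕ N) (b %ℕ N)) ⟨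
    ζ^ (+ (a %ℕ N ℕ.+ b %ℕ N))             ≈⟨ ζ^-pos _ ⟩
    pow ζ (a %ℕ N ℕ.+ b %ℕ N)              ≈⟨ pow-+ ζ (a %ℕ N) (b %ℕ N) ⟩
    ζ^ a * ζ^ b                            ∎

  ζ^≈1 : ∀ {k} → k ≡ + 0 mod N → ζ^ k ≈ 1#
  ζ^≈1 {k} k≡0 = trans (reflexive (ζ^-cong k≡0)) (ζ^-pos 0)

  ζ^-pow : ∀ k a → ζ^ (k ℤ.* + a) ≈ pow (ζ^ k) a
  ζ^-pow k zero = ζ^≈1 (P.subst (_≡ + 0 mod N) (P.sym (ℤP.*-zeroʳ k)) (mod-refl (+ 0)))
  ζ^-pow k (suc a) = begin
    ζ^ (k ℤ.* + suc a)                     ≡⟨ P.cong ζ^ (P.trans (P.cong (k ℤ.*_) (ℤP.pos-+ 1 a)) (ℤP.*-distribˡ-+ k (+ 1) (+ a))) ⟩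
    ζ^ (k ℤ.* + 1 ℤ.+ k ℤ.* + a)           ≈⟨ ζ^-+ (k ℤ.* + 1) (k ℤ.* + a) ⟩
    ζ^ (k ℤ.* + 1) * ζ^ (k ℤ.* + a)        ≈⟨ *-cong (reflexive (P.cong ζ^ (ℤP.*-identityʳ k))) (ζ^-pow k a) ⟩
    ζ^ k * pow (ζ^ k) a                    ∎

  ζ^≈1⇒≡0 : ∀ k → ζ^ k ≈ 1# → k ≡ + 0 mod N
  ζ^≈1⇒≡0 k ζ^k≈1 with k %ℕ N in k%N≡r
  ... | zero = P.subst (k ≡_mod N) (P.cong +_ k%N≡r) (≡-%ℕ k N)
  ... | suc r = contradiction ζ^k≈1 (ζ-primitive (suc r) (ℕ.s≤s ℕ.z≤n) (P.subst (ℕ._< N) k%N≡r (n%ℕd<d k N)))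

  e≈ζ^ : ∀ q .{{_ : NonZero q}} → q ∣ N → ∀ x → WithField.e C q x ≈ ζ^ (+ (N / q) ℤ.* x)
  e≈ζ^ q q∣N x = begin
    pow ζ ((N / q) ℕ.* (x %ℕ q))       ≈⟨ ζ^-pos _ ⟨
    ζ^ (+ ((N / q) ℕ.* (x %ℕ q)))      ≡⟨ ζ^-cong (P.subst (_≡ + (N / q) ℤ.* x mod N) (P.sym (ℤP.pos-* (N / q) (x %ℕ q)))
                                            (mod-scale-cofactor q∣N (mod-sym (≡-%ℕ x q)))) ⟩
    ζ^ (+ (N / q) ℤ.* x)               ∎

  -- x = a / (b + 1) for natural numbers a and b; in characteristic 0 this is enough
  -- positivity to see that G(R) ≠ 0.

  NonNegative : Carrier → Set
  NonNegative x = ∃[ a ] ∃[ b ] x * fromℕ (suc b) ≈ fromℕ a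

  Positive : Carrier → Set
  Positive x = ∃[ a ] ∃[ b ] x * fromℕ (suc b) ≈ fromℕ (suc a)

  private
    [x+y][uv]≈xu·v+yv·u : ∀ {x y u v a c} → x * u ≈ a → y * v ≈ c → (x + y) * (u * v) ≈ a * v + c * u
    [x+y][uv]≈xu·v+yv·u {x} {y} {u} {v} xu≈a yv≈c = begin
      (x + y) * (u * v)           ≈⟨ solve 4 (λ x y u v → (x :+ y) :* (u :* v) := (x :* u) :* v :+ (y :* v) :* u) refl x y u v ⟩
      (x * u) * v + (y * v) * u   ≈⟨ +-cong (*-congʳ xu≈a) (*-congʳ yv≈c) ⟩
      _                           ∎

  nonNegative-cong : ∀ {x y} → x ≈ y → NonNegative x → NonNegative y
  nonNegative-cong x≈y (a , b , eq) = a , b , trans (*-congʳ (sym x≈y)) eq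

  positive-cong : ∀ {x y} → x ≈ y → Positive x → Positive y
  positive-cong x≈y (a , b , eq) = a , b , trans (*-congʳ (sym x≈y)) eq

  nonNegative-0 : NonNegative 0#
  nonNegative-0 = 0 , 0 , zeroˡ _

  positive-1 : Positive 1#
  positive-1 = 0 , 0 , *-identityˡ _

  nonNegative-+ : ∀ {x y} → NonNegative x → NonNegative y → NonNegative (x + y)
  nonNegative-+ (a₁ , b₁ , eq₁) (a₂ , b₂ , eq₂) = a₁ ℕ.* suc b₂ ℕ.+ a₂ ℕ.* suc b₁ , b₂ ℕ.+ b₁ ℕ.* suc b₂ ,
    trans (*-congˡ (fromℕ-* (suc b₁) (suc b₂))) (trans ([x+y][uv]≈xu·v+yv·u eq₁ eq₂)
      (sym (trans (fromℕ-+ (a₁ ℕ.* suc b₂) (a₂ ℕ.* suc b₁)) (+-cong (fromℕ-* a₁ (suc b₂)) (fromℕ-* a₂ (suc b₁))))))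

  positive-+ : ∀ {x y} → Positive x → NonNegative y → Positive (x + y)
  positive-+ (a₁ , b₁ , eq₁) (a₂ , b₂ , eq₂) = b₂ ℕ.+ a₁ ℕ.* suc b₂ ℕ.+ a₂ ℕ.* suc b₁ , b₂ ℕ.+ b₁ ℕ.* suc b₂ ,
    trans (*-congˡ (fromℕ-* (suc b₁) (suc b₂))) (trans ([x+y][uv]≈xu·v+yv·u eq₁ eq₂)
      (sym (trans (fromℕ-+ (suc a₁ ℕ.* suc b₂) (a₂ ℕ.* suc b₁)) (+-cong (fromℕ-* (suc a₁) (suc b₂)) (fromℕ-* a₂ (suc b₁))))))

  nonNegative-* : ∀ {x y} → NonNegative x → NonNegative y → NonNegative (x * y)
  nonNegative-* {x} {y} (a₁ , b₁ , eq₁) (a₂ , b₂ , eq₂) = a₁ ℕ.* a₂ , b₂ ℕ.+ b₁ ℕ.* suc b₂ ,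
    trans (*-congˡ (fromℕ-* (suc b₁) (suc b₂)))
      (trans (*-interchange x y _ _)
        (trans (*-cong eq₁ eq₂) (sym (fromℕ-* a₁ a₂))))

  positive⇒≉0 : ∀ {x} → Positive x → x ≉ 0#
  positive⇒≉0 (a , b , eq) x≈0 = charZero a (trans (sym eq) (trans (*-congʳ x≈0) (zeroˡ _)))

module Expansion {N : ℕ} (C : CycloField N) .{{_ : NonZero N}} (F : LinFactors) (n : ℤ)
                 (|X|>0 : ∀ q → 1 ≤ q → 0 < cardX F q) where

  private module ℤ-identities where
    open +-*-Solver

    t[am]+t[-an]≡t[a[m-n]] : ∀ t a m n → t ℤ.* (a ℤ.* m) ℤ.+ t ℤ.* (ℤ.- (a ℤ.* n)) ≡ t ℤ.* (a ℤ.* (m ℤ.- n))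
    t[am]+t[-an]≡t[a[m-n]] = solve 4 (λ t a m n → t :* (a :* m) :+ t :* (:- (a :* n)) := t :* (a :* (m :- n))) P.refl

    t[[xe+yd]D]≡te[xD]+td[yD] : ∀ t e d x y D → t ℤ.* ((x ℤ.* e ℤ.+ y ℤ.* d) ℤ.* D) ≡ (t ℤ.* e) ℤ.* (x ℤ.* D) ℤ.+ (t ℤ.* d) ℤ.* (y ℤ.* D)
    t[[xe+yd]D]≡te[xD]+td[yD] = solve 6 (λ t e d x y D → t :* ((x :* e :+ y :* d) :* D) := (t :* e) :* (x :* D) :+ (t :* d) :* (y :* D)) P.refl

    t[aD]≡[tD]a : ∀ t a D → t ℤ.* (a ℤ.* D) ≡ (t ℤ.* D) ℤ.* a
    t[aD]≡[tD]a = solve 3 (λ t a D → t :* (a :* D) := (t :* D) :* a) P.refl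

    [tD]p≡D[tp] : ∀ t D p → (t ℤ.* D) ℤ.* p ≡ D ℤ.* (t ℤ.* p)
    [tD]p≡D[tp] = solve 3 (λ t D p → (t :* D) :* p := D :* (t :* p)) P.refl

    t[a[[m+s]-n]]≡t[a[m-n]]+t[as] : ∀ t a m s n → t ℤ.* (a ℤ.* ((m ℤ.+ s) ℤ.- n)) ≡ t ℤ.* (a ℤ.* (m ℤ.- n)) ℤ.+ t ℤ.* (a ℤ.* s)
    t[a[[m+s]-n]]≡t[a[m-n]]+t[as] = solve 5 (λ t a m s n → t :* (a :* ((m :+ s) :- n)) := t :* (a :* (m :- n)) :+ t :* (a :* s)) P.refl
  open ℤ-identities

  open CycloField C
  open RingProperties K
  open CyclotomicField C
  open import Relation.Binary.Reasoning.Setoid setoid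
  open import Algebra.Properties.Ring ring using (-‿distribˡ-*; -‿distribʳ-*)
  private module W = WithField C

  X? : (q m : ℕ) → Dec (gcd q ∣ evalF F (+ m) ∣ ≡ 1)
  X? q m = gcd q ∣ evalF F (+ m) ∣ ℕ.≟ 1

  unit? : (q a : ℕ) → Dec (gcd a q ≡ 1)
  unit? q a = gcd a q ℕ.≟ 1

  |X| : ℕ → Carrier
  |X| q = fromℕ (cardX F q)

  -- ζ^ (angle q a m) = e_q(a(m - n))
  angle : (q : ℕ) .{{_ : NonZero q}} → ℕ → ℕ → ℤ
  angle q a m = + (N / q) ℤ.* (+ a ℤ.* (+ m ℤ.- n))

  expSum : (q : ℕ) .{{_ : NonZero q}} → ℕ → Carrier
  expSum q a = ∑ (λ m → 𝟙 (X? q m) * ζ^ (angle q a m)) (upTo q)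

  doubleSum : (q : ℕ) .{{_ : NonZero q}} → Carrier
  doubleSum q = ∑ (λ a → 𝟙 (unit? q a) * expSum q a) (upTo q)

  αTerm : (q : ℕ) .{{_ : NonZero q}} → Carrier
  αTerm q = W.sumK (map (λ a → W.s F a q * W.e q (ℤ.- (+ a ℤ.* n))) (units q))

  |X|≈∑𝟙 : ∀ q → |X| q ≈ ∑ (λ m → 𝟙 (X? q m)) (upTo q)
  |X|≈∑𝟙 q = fromℕ-length-filter (X? q) (upTo q)

  |X|≉0 : ∀ q .{{_ : NonZero q}} → |X| q ≉ 0#
  |X|≉0 q with cardX F q | |X|>0 q (ℕ.>-nonZero⁻¹ q)
  ... | suc k | _ = charZero k

  αTerm≈|X|⁻¹*doubleSum : ∀ q .{{_ : NonZero q}} → q ∣ N → αTerm q ≈ |X| q ⁻¹ * doubleSum q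
  αTerm≈|X|⁻¹*doubleSum q q∣N = begin
    ∑ f (filter (unit? q) (upTo q))                               ≈⟨ ∑-filter (unit? q) f (upTo q) ⟩
    ∑ (λ a → 𝟙 (unit? q a) * f a) (upTo q)                        ≈⟨ ∑-cong (upTo q) (λ a → *-congˡ (f≈ a)) ⟩
    ∑ (λ a → 𝟙 (unit? q a) * (|X| q ⁻¹ * expSum q a)) (upTo q)    ≈⟨ ∑-cong (upTo q) (λ a → solve 3 (λ u c m → u :* (c :* m) := c :* (u :* m)) refl _ _ _) ⟩
    ∑ (λ a → |X| q ⁻¹ * (𝟙 (unit? q a) * expSum q a)) (upTo q)    ≈⟨ ∑-*ˡ (|X| q ⁻¹) _ (upTo q) ⟨
    |X| q ⁻¹ * doubleSum q                                        ∎
    where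
    f : ℕ → Carrier
    f a = W.s F a q * W.e q (ℤ.- (+ a ℤ.* n))
    e*e≈ζ^ : ∀ a m → W.e q (+ (a ℕ.* m)) * W.e q (ℤ.- (+ a ℤ.* n)) ≈ ζ^ (angle q a m)
    e*e≈ζ^ a m = begin
      W.e q (+ (a ℕ.* m)) * W.e q (ℤ.- (+ a ℤ.* n))                       ≈⟨ *-cong (e≈ζ^ q q∣N _) (e≈ζ^ q q∣N _) ⟩
      ζ^ (+ (N / q) ℤ.* + (a ℕ.* m)) * ζ^ (+ (N / q) ℤ.* (ℤ.- (+ a ℤ.* n))) ≈⟨ ζ^-+ (+ (N / q) ℤ.* + (a ℕ.* m)) (+ (N / q) ℤ.* (ℤ.- (+ a ℤ.* n))) ⟨
      ζ^ (+ (N / q) ℤ.* + (a ℕ.* m) ℤ.+ + (N / q) ℤ.* (ℤ.- (+ a ℤ.* n)))    ≡⟨ P.cong (λ z → ζ^ (+ (N / q) ℤ.* z ℤ.+ + (N / q) ℤ.* (ℤ.- (+ a ℤ.* n)))) (ℤP.pos-* a m) ⟩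
      ζ^ (+ (N / q) ℤ.* (+ a ℤ.* + m) ℤ.+ + (N / q) ℤ.* (ℤ.- (+ a ℤ.* n))) ≡⟨ P.cong ζ^ (t[am]+t[-an]≡t[a[m-n]] (+ (N / q)) (+ a) (+ m) n) ⟩
      ζ^ (angle q a m)                                                    ∎
    f≈ : ∀ a → f a ≈ |X| q ⁻¹ * expSum q a
    f≈ a = begin
      (|X| q ⁻¹ * ∑ (λ m → W.e q (+ (a ℕ.* m))) (Xlist F q)) * W.e q (ℤ.- (+ a ℤ.* n))              ≈⟨ *-assoc _ _ _ ⟩
      |X| q ⁻¹ * (∑ (λ m → W.e q (+ (a ℕ.* m))) (Xlist F q) * W.e q (ℤ.- (+ a ℤ.* n)))            ≈⟨ *-congˡ (∑-*ʳ _ _ (Xlist F q)) ⟩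
      |X| q ⁻¹ * ∑ (λ m → W.e q (+ (a ℕ.* m)) * W.e q (ℤ.- (+ a ℤ.* n))) (Xlist F q)              ≈⟨ *-congˡ (∑-filter (X? q) _ (upTo q)) ⟩
      |X| q ⁻¹ * ∑ (λ m → 𝟙 (X? q m) * (W.e q (+ (a ℕ.* m)) * W.e q (ℤ.- (+ a ℤ.* n)))) (upTo q) ≈⟨ *-congˡ (∑-cong (upTo q) (λ m → *-congˡ (e*e≈ζ^ a m))) ⟩
      |X| q ⁻¹ * expSum q a                                                                        ∎

  -- Multiplicativity, by the Chinese remainder theorem

  X-cong : ∀ {q} x y → x ≡ y mod q → gcd q ∣ evalF F x ∣ ≡ 1 → gcd q ∣ evalF F y ∣ ≡ 1
  X-cong {q} x y x≡y q⊥Fx = Coprime.coprime⇒gcd≡1 {q} {∣ evalF F y ∣} (coprime-cong-mod (evalF-cong F x≡y) (Coprime.gcd≡1⇒coprime q⊥Fx))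

  module _ (d e : ℕ) .{{_ : NonZero d}} .{{_ : NonZero e}} (d⊥e : Coprime d e) where

    private instance
      de≢0 : NonZero (d ℕ.* e)
      de≢0 = ℕP.m*n≢0 d e

    𝟙X-crt : ∀ m → 𝟙 (X? (d ℕ.* e) m) ≈ 𝟙 (X? d (m % d)) * 𝟙 (X? e (m % e))
    𝟙X-crt m = trans (𝟙-⇔ (X? (d ℕ.* e) m) (X? d (m % d) ×-dec X? e (m % e)) to from) (𝟙-× (X? d (m % d)) (X? e (m % e)) (X? d (m % d) ×-dec X? e (m % e)))
      where
      Fm = ∣ evalF F (+ m) ∣
      to : gcd (d ℕ.* e) Fm ≡ 1 → gcd d ∣ evalF F (+ (m % d)) ∣ ≡ 1 × gcd e ∣ evalF F (+ (m % e)) ∣ ≡ 1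
      to de⊥Fm = X-cong (+ m) (+ (m % d)) (≡-%ℕ (+ m) d) (Coprime.coprime⇒gcd≡1 {d} {Fm} (coprime-∣ˡ (ℕD.m∣m*n e) (Coprime.gcd≡1⇒coprime de⊥Fm)))
               , X-cong (+ m) (+ (m % e)) (≡-%ℕ (+ m) e) (Coprime.coprime⇒gcd≡1 {e} {Fm} (coprime-∣ˡ (ℕD.n∣m*n d) (Coprime.gcd≡1⇒coprime de⊥Fm)))
      from : gcd d ∣ evalF F (+ (m % d)) ∣ ≡ 1 × gcd e ∣ evalF F (+ (m % e)) ∣ ≡ 1 → gcd (d ℕ.* e) Fm ≡ 1
      from (d⊥ , e⊥) = Coprime.coprime⇒gcd≡1 {d ℕ.* e} {Fm} (coprime-*ˡ {d} {e} {Fm}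
        (Coprime.gcd≡1⇒coprime (X-cong (+ (m % d)) (+ m) (mod-sym (≡-%ℕ (+ m) d)) d⊥))
        (Coprime.gcd≡1⇒coprime (X-cong (+ (m % e)) (+ m) (mod-sym (≡-%ℕ (+ m) e)) e⊥)))

    |X|-crt : |X| (d ℕ.* e) ≈ |X| d * |X| e
    |X|-crt = begin
      |X| (d ℕ.* e)                                                       ≈⟨ |X|≈∑𝟙 (d ℕ.* e) ⟩
      ∑ (λ m → 𝟙 (X? (d ℕ.* e) m)) (upTo (d ℕ.* e))                       ≈⟨ ∑-cong (upTo (d ℕ.* e)) 𝟙X-crt ⟩
      ∑ (λ m → 𝟙 (X? d (m % d)) * 𝟙 (X? e (m % e))) (upTo (d ℕ.* e))      ≈⟨ ∑-crt-split d e d⊥e (λ u → 𝟙 (X? d u)) (λ v → 𝟙 (X? e v)) ⟩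
      ∑ (λ u → 𝟙 (X? d u)) (upTo d) * ∑ (λ v → 𝟙 (X? e v)) (upTo e)       ≈⟨ *-cong (|X|≈∑𝟙 d) (|X|≈∑𝟙 e) ⟨
      |X| d * |X| e                                                       ∎

    𝟙unit-crt : ∀ x y → 𝟙 (unit? (d ℕ.* e) (crt-join d e (x , y))) ≈ 𝟙 (unit? d x) * 𝟙 (unit? e y)
    𝟙unit-crt x y = trans (𝟙-⇔ (unit? (d ℕ.* e) j) (unit? d x ×-dec unit? e y) to from) (𝟙-× (unit? d x) (unit? e y) (unit? d x ×-dec unit? e y))
      where
      j = crt-join d e (x , y)
      to : gcd j (d ℕ.* e) ≡ 1 → gcd x d ≡ 1 × gcd y e ≡ 1
      to j⊥de = let (x⊥d , y⊥e) = Equivalence.to (coprime-crt-join d e d⊥e x y) (Coprime.gcd≡1⇒coprime j⊥de)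
                in Coprime.coprime⇒gcd≡1 {x} {d} x⊥d , Coprime.coprime⇒gcd≡1 {y} {e} y⊥e
      from : gcd x d ≡ 1 × gcd y e ≡ 1 → gcd j (d ℕ.* e) ≡ 1
      from (x⊥d , y⊥e) = Coprime.coprime⇒gcd≡1 {j} {d ℕ.* e}
        (Equivalence.from (coprime-crt-join d e d⊥e x y) (Coprime.gcd≡1⇒coprime x⊥d , Coprime.gcd≡1⇒coprime y⊥e))

    module _ (de∣N : d ℕ.* e ∣ N) where

      ζ^-crt : ∀ x y m → ζ^ (angle (d ℕ.* e) (crt-join d e (x , y)) m) ≈ ζ^ (angle d x (m % d)) * ζ^ (angle e y (m % e))
      ζ^-crt x y m = begin
        ζ^ (+ t ℤ.* (+ j ℤ.* D))                                    ≡⟨ ζ^-cong (mod-scale-cofactor de∣N (mod-* (crt-join-≡ d e x y) (mod-refl D))) ⟩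
        ζ^ (+ t ℤ.* ((+ x ℤ.* + e ℤ.+ + y ℤ.* + d) ℤ.* D))          ≡⟨ P.cong ζ^ (P.trans (t[[xe+yd]D]≡te[xD]+td[yD] (+ t) (+ e) (+ d) (+ x) (+ y) D)
                                                                          (P.cong₂ (λ u v → u ℤ.* (+ x ℤ.* D) ℤ.+ v ℤ.* (+ y ℤ.* D)) te≡N/d td≡N/e)) ⟩
        ζ^ (+ (N / d) ℤ.* (+ x ℤ.* D) ℤ.+ + (N / e) ℤ.* (+ y ℤ.* D)) ≈⟨ ζ^-+ (+ (N / d) ℤ.* (+ x ℤ.* D)) (+ (N / e) ℤ.* (+ y ℤ.* D)) ⟩
        ζ^ (+ (N / d) ℤ.* (+ x ℤ.* D)) * ζ^ (+ (N / e) ℤ.* (+ y ℤ.* D)) ≡⟨ P.cong₂ _*_ (ζ^-cong (reduce d∣N x)) (ζ^-cong (reduce e∣N y)) ⟩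
        ζ^ (angle d x (m % d)) * ζ^ (angle e y (m % e))              ∎
        where
        t = N / (d ℕ.* e)
        j = crt-join d e (x , y)
        D = + m ℤ.- n
        d∣N = ℕD.∣-trans (ℕD.m∣m*n e) de∣N
        e∣N = ℕD.∣-trans (ℕD.n∣m*n d) de∣N
        te≡N/d : + t ℤ.* + e ≡ + (N / d)
        te≡N/d = P.trans (P.sym (ℤP.pos-* t e)) (P.cong +_ ([n/[d*e]]*e≡n/d N d e de∣N))
        td≡N/e : + t ℤ.* + d ≡ + (N / e)
        td≡N/e = P.trans (P.sym (ℤP.pos-* t d)) (P.cong +_ ([n/[d*e]]*d≡n/e N d e de∣N))
        reduce : ∀ {k} .{{_ : NonZero k}} → k ∣ N → ∀ a → + (N / k) ℤ.* (+ a ℤ.* D) ≡ + (N / k) ℤ.* (+ a ℤ.* (+ (m % k) ℤ.- n)) mod N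
        reduce {k} k∣N a = mod-scale-cofactor k∣N (mod-*ˡ (+ a) (mod-+ (≡-%ℕ (+ m) k) (mod-refl (ℤ.- n))))

      expSum-crt : ∀ x y → expSum (d ℕ.* e) (crt-join d e (x , y)) ≈ expSum d x * expSum e y
      expSum-crt x y = begin
        ∑ (λ m → 𝟙 (X? (d ℕ.* e) m) * ζ^ (angle (d ℕ.* e) (crt-join d e (x , y)) m)) (upTo (d ℕ.* e)) ≈⟨ ∑-cong (upTo (d ℕ.* e)) split ⟩
        ∑ (λ m → f (m % d) * g (m % e)) (upTo (d ℕ.* e))                                            ≈⟨ ∑-crt-split d e d⊥e f g ⟩
        expSum d x * expSum e y                                                                     ∎
        where
        f = λ u → 𝟙 (X? d u) * ζ^ (angle d x u)
        g = λ v → 𝟙 (X? e v) * ζ^ (angle e y v)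
        split : ∀ m → 𝟙 (X? (d ℕ.* e) m) * ζ^ (angle (d ℕ.* e) (crt-join d e (x , y)) m) ≈ f (m % d) * g (m % e)
        split m = trans (*-cong (𝟙X-crt m) (ζ^-crt x y m)) (*-interchange _ _ _ _)

      doubleSum-crt : doubleSum (d ℕ.* e) ≈ doubleSum d * doubleSum e
      doubleSum-crt = begin
        doubleSum (d ℕ.* e)                                                            ≈⟨ ∑-crt-join d e d⊥e (λ a → 𝟙 (unit? (d ℕ.* e) a) * expSum (d ℕ.* e) a) ⟩
        ∑ (λ x → ∑ (λ y → 𝟙 (unit? (d ℕ.* e) (j x y)) * expSum (d ℕ.* e) (j x y)) (upTo e)) (upTo d)
          ≈⟨ ∑-cong (upTo d) (λ x → ∑-cong (upTo e) (split x)) ⟩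
        ∑ (λ x → ∑ (λ y → (𝟙 (unit? d x) * expSum d x) * (𝟙 (unit? e y) * expSum e y)) (upTo e)) (upTo d)
          ≈⟨ ∑-*-∑ (λ x → 𝟙 (unit? d x) * expSum d x) (λ y → 𝟙 (unit? e y) * expSum e y) (upTo d) (upTo e) ⟩
        doubleSum d * doubleSum e                                                      ∎
        where
        j = λ x y → crt-join d e (x , y)
        split : ∀ x y → 𝟙 (unit? (d ℕ.* e) (j x y)) * expSum (d ℕ.* e) (j x y) ≈ (𝟙 (unit? d x) * expSum d x) * (𝟙 (unit? e y) * expSum e y)
        split x y = trans (*-cong (𝟙unit-crt x y) (expSum-crt x y)) (*-interchange _ _ _ _)

      αTerm-* : αTerm (d ℕ.* e) ≈ αTerm d * αTerm e
      αTerm-* = begin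
        αTerm (d ℕ.* e)                                 ≈⟨ αTerm≈|X|⁻¹*doubleSum (d ℕ.* e) de∣N ⟩
        |X| (d ℕ.* e) ⁻¹ * doubleSum (d ℕ.* e)          ≈⟨ *-cong (trans (⁻¹-cong (|X|≉0 (d ℕ.* e)) |X|-crt) (⁻¹-* (|X|≉0 d) (|X|≉0 e))) doubleSum-crt ⟩
        (|X| d ⁻¹ * |X| e ⁻¹) * (doubleSum d * doubleSum e) ≈⟨ *-interchange _ _ _ _ ⟩
        (|X| d ⁻¹ * doubleSum d) * (|X| e ⁻¹ * doubleSum e) ≈⟨ *-cong (αTerm≈|X|⁻¹*doubleSum d (ℕD.∣-trans (ℕD.m∣m*n e) de∣N))
                                                                     (αTerm≈|X|⁻¹*doubleSum e (ℕD.∣-trans (ℕD.n∣m*n d) de∣N)) ⟨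
        αTerm d * αTerm e                               ∎

  -- Prime moduli

  module _ (p : ℕ) (p-prime : Prime p) (p∣N : p ∣ N) where

    private instance
      p≢0 : NonZero p
      p≢0 = prime⇒nonZero p-prime

    𝟙unit-prime : ∀ a → a ℕ.< p → 𝟙 (unit? p a) ≈ 1# - 𝟙 (a ℕ.≟ 0)
    𝟙unit-prime a a<p = trans (𝟙-⇔ (unit? p a) (¬? (a ℕ.≟ 0)) to from) (𝟙-¬ (a ℕ.≟ 0) (¬? (a ℕ.≟ 0)))
      where
      to : gcd a p ≡ 1 → a ≢ 0
      to a⊥p P.refl = ¬coprime-0-prime p-prime (Coprime.gcd≡1⇒coprime a⊥p)
      from : a ≢ 0 → gcd a p ≡ 1
      from a≢0 = Coprime.coprime⇒gcd≡1 {a} {p} (<prime⇒coprime p-prime a<p a≢0)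

    private
      t = N / p

      D : ℕ → ℤ
      D m = + m ℤ.- n

      ω : ℕ → Carrier
      ω m = ζ^ (+ t ℤ.* D m)

      δ : ℕ → Carrier
      δ m = 𝟙 (p ∣? ∣ D m ∣)

      ζ^angle≈pow-ω : ∀ a m → ζ^ (angle p a m) ≈ pow (ω m) a
      ζ^angle≈pow-ω a m = trans (reflexive (P.cong ζ^ (t[aD]≡[tD]a (+ t) (+ a) (D m)))) (ζ^-pow (+ t ℤ.* D m) a)

      ∑pow-ω : ∀ m → ∑ (pow (ω m)) (upTo p) ≈ fromℕ p * δ m
      ∑pow-ω m with p ∣? ∣ D m ∣
      ... | yes p∣D = begin
        ∑ (pow (ω m)) (upTo p)     ≈⟨ ∑-cong (upTo p) (λ a → trans (pow-cong a ω≈1) (pow-1# a)) ⟩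
        ∑ (λ _ → 1#) (upTo p)      ≈⟨ ∑-1 (upTo p) ⟩
        fromℕ (length (upTo p))    ≡⟨ P.cong fromℕ (List.length-upTo p) ⟩
        fromℕ p                    ≈⟨ *-identityʳ _ ⟨
        fromℕ p * 1#               ∎
        where
        ω≈1 : ω m ≈ 1#
        ω≈1 = ζ^≈1 (P.subst (+ t ℤ.* D m ≡_mod N) (ℤP.*-zeroʳ (+ t)) (mod-scale-cofactor p∣N (∣⇒≡mod0 p∣D)))
      ... | no p∤D = trans (∑pow≈0 (ω m) p ω≉1 ωᵖ≈1) (sym (zeroʳ _))
        where
        ω≉1 : ω m ≉ 1#
        ω≉1 ω≈1 = p∤D ([n/p]*x≡0⇒p∣x (D m) p∣N (ζ^≈1⇒≡0 (+ t ℤ.* D m) ω≈1))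
        tDp≡DN : (+ t ℤ.* D m) ℤ.* + p ≡ D m ℤ.* + N
        tDp≡DN = P.trans ([tD]p≡D[tp] (+ t) (D m) (+ p)) (P.cong (D m ℤ.*_) (P.trans (P.sym (ℤP.pos-* t p)) (P.cong +_ (ℕM.m/n*n≡m p∣N))))
        ωᵖ≈1 : pow (ω m) p ≈ 1#
        ωᵖ≈1 = trans (sym (ζ^-pow (+ t ℤ.* D m) p)) (ζ^≈1 (P.subst (_≡ + 0 mod N) (P.sym tDp≡DN) (x*q≡0-mod (D m))))

      ∑unit-ζ^angle : ∀ m → ∑ (λ a → 𝟙 (unit? p a) * ζ^ (angle p a m)) (upTo p) ≈ fromℕ p * δ m - 1#
      ∑unit-ζ^angle m = begin
        ∑ (λ a → 𝟙 (unit? p a) * ζ^ (angle p a m)) (upTo p)               ≈⟨ ∑-upTo-cong p (λ a a<p → *-cong (𝟙unit-prime a a<p) (ζ^angle≈pow-ω a m)) ⟩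
        ∑ (λ a → (1# - 𝟙 (a ℕ.≟ 0)) * pow (ω m) a) (upTo p)               ≈⟨ ∑-cong (upTo p) (λ a → [1-i]w≈w-iw (𝟙 (a ℕ.≟ 0)) (pow (ω m) a)) ⟩
        ∑ (λ a → pow (ω m) a - 𝟙 (a ℕ.≟ 0) * pow (ω m) a) (upTo p)        ≈⟨ ∑-+ _ _ (upTo p) ⟩
        ∑ (pow (ω m)) (upTo p) + ∑ (λ a → - (𝟙 (a ℕ.≟ 0) * pow (ω m) a)) (upTo p)
          ≈⟨ +-cong (∑pow-ω m) (trans (∑-neg _ (upTo p)) (-‿cong (∑-δ 0 p (ℕ.>-nonZero⁻¹ p) (pow (ω m))))) ⟩
        fromℕ p * δ m - 1#                                                ∎
        where
        [1-i]w≈w-iw : ∀ i w → (1# - i) * w ≈ w - i * w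
        [1-i]w≈w-iw i w = trans (distribʳ w 1# (- i)) (+-cong (*-identityˡ w) (sym (-‿distribˡ-* i w)))

      δ≈𝟙[m≡n] : ∀ m → m ℕ.< p → δ m ≈ 𝟙 (m ℕ.≟ n %ℕ p)
      δ≈𝟙[m≡n] m m<p = 𝟙-⇔ (p ∣? ∣ D m ∣) (m ℕ.≟ n %ℕ p) to from
        where
        to : p ∣ ∣ D m ∣ → m ≡ n %ℕ p
        to p∣D = P.sym (%ℕ-unique m<p (mod-sym (-≡0⇒≡mod {x = + m} {n} (∣⇒≡mod0 p∣D))))
        from : m ≡ n %ℕ p → p ∣ ∣ D m ∣
        from P.refl = ≡mod0⇒∣ (≡mod⇒-≡0 (mod-sym (≡-%ℕ n p)))

    doubleSum-prime : doubleSum p ≈ fromℕ p * 𝟙 (X? p (n %ℕ p)) - |X| p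
    doubleSum-prime = begin
      doubleSum p                                                                     ≈⟨ ∑-cong (upTo p) (λ a → ∑-*ˡ (𝟙 (unit? p a)) _ (upTo p)) ⟩
      ∑ (λ a → ∑ (λ m → 𝟙 (unit? p a) * (𝟙 (X? p m) * ζ^ (angle p a m))) (upTo p)) (upTo p) ≈⟨ ∑-comm _ (upTo p) (upTo p) ⟩
      ∑ (λ m → ∑ (λ a → 𝟙 (unit? p a) * (𝟙 (X? p m) * ζ^ (angle p a m))) (upTo p)) (upTo p) ≈⟨ ∑-cong (upTo p) (λ m → pull (𝟙 (X? p m)) m) ⟩
      ∑ (λ m → 𝟙 (X? p m) * (fromℕ p * δ m - 1#)) (upTo p)                            ≈⟨ ∑-cong (upTo p) (λ m → expand (𝟙 (X? p m)) (fromℕ p) (δ m)) ⟩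
      ∑ (λ m → fromℕ p * (𝟙 (X? p m) * δ m) - 𝟙 (X? p m)) (upTo p)                    ≈⟨ ∑-+ _ _ (upTo p) ⟩
      ∑ (λ m → fromℕ p * (𝟙 (X? p m) * δ m)) (upTo p) + ∑ (λ m → - 𝟙 (X? p m)) (upTo p) ≈⟨ +-cong (sym (∑-*ˡ (fromℕ p) _ (upTo p))) (∑-neg _ (upTo p)) ⟩
      fromℕ p * ∑ (λ m → 𝟙 (X? p m) * δ m) (upTo p) - ∑ (λ m → 𝟙 (X? p m)) (upTo p)   ≈⟨ +-cong (*-congˡ ∑𝟙X*δ) (-‿cong (sym (|X|≈∑𝟙 p))) ⟩
      fromℕ p * 𝟙 (X? p (n %ℕ p)) - |X| p                                             ∎
      where
      pull : ∀ x m → ∑ (λ a → 𝟙 (unit? p a) * (x * ζ^ (angle p a m))) (upTo p) ≈ x * (fromℕ p * δ m - 1#)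
      pull x m = begin
        ∑ (λ a → 𝟙 (unit? p a) * (x * ζ^ (angle p a m))) (upTo p)  ≈⟨ ∑-cong (upTo p) (λ a → solve 3 (λ u x e → u :* (x :* e) := x :* (u :* e)) refl _ _ _) ⟩
        ∑ (λ a → x * (𝟙 (unit? p a) * ζ^ (angle p a m))) (upTo p)  ≈⟨ ∑-*ˡ x _ (upTo p) ⟨
        x * ∑ (λ a → 𝟙 (unit? p a) * ζ^ (angle p a m)) (upTo p)    ≈⟨ *-congˡ (∑unit-ζ^angle m) ⟩
        x * (fromℕ p * δ m - 1#)                                   ∎
      expand : ∀ x P d → x * (P * d - 1#) ≈ P * (x * d) - x
      expand x P d = trans (distribˡ x (P * d) (- 1#))
        (+-cong (solve 3 (λ x P d → x :* (P :* d) := P :* (x :* d)) refl x P d) (trans (sym (-‿distribʳ-* x 1#)) (-‿cong (*-identityʳ x))))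
      ∑𝟙X*δ : ∑ (λ m → 𝟙 (X? p m) * δ m) (upTo p) ≈ 𝟙 (X? p (n %ℕ p))
      ∑𝟙X*δ = begin
        ∑ (λ m → 𝟙 (X? p m) * δ m) (upTo p)                ≈⟨ ∑-upTo-cong p (λ m m<p → trans (*-congˡ (δ≈𝟙[m≡n] m m<p)) (*-comm _ _)) ⟩
        ∑ (λ m → 𝟙 (m ℕ.≟ n %ℕ p) * 𝟙 (X? p m)) (upTo p)   ≈⟨ ∑-δ (n %ℕ p) p (n%ℕd<d n p) (λ m → 𝟙 (X? p m)) ⟩
        𝟙 (X? p (n %ℕ p))                                  ∎

    αTerm-prime : αTerm p ≈ 𝟙 (X? p (n %ℕ p)) * (fromℕ p * |X| p ⁻¹) - 1#
    αTerm-prime = begin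
      αTerm p                                              ≈⟨ αTerm≈|X|⁻¹*doubleSum p p∣N ⟩
      |X| p ⁻¹ * doubleSum p                               ≈⟨ *-congˡ doubleSum-prime ⟩
      |X| p ⁻¹ * (fromℕ p * i - |X| p)                     ≈⟨ distribˡ _ _ _ ⟩
      |X| p ⁻¹ * (fromℕ p * i) + |X| p ⁻¹ * - |X| p        ≈⟨ +-cong (solve 3 (λ a b c → a :* (b :* c) := c :* (b :* a)) refl _ _ _)
                                                                     (trans (sym (-‿distribʳ-* _ _)) (-‿cong (inverseˡ (|X|≉0 p)))) ⟩
      i * (fromℕ p * |X| p ⁻¹) - 1#                        ∎
      where
      i = 𝟙 (X? p (n %ℕ p))

  -- Moduli divisible by the square of a prime

  module _ (q p : ℕ) .{{_ : NonZero q}} (p-prime : Prime p) (p²∣q : p ℕ.* p ∣ q) (q∣N : q ∣ N) where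

    private
      instance
        p≢0 : NonZero p
        p≢0 = prime⇒nonZero p-prime

      p∣q : p ∣ q
      p∣q = ℕD.∣-trans (ℕD.m∣m*n p) p²∣q

      s = q / p

      s*p≡q : s ℕ.* p ≡ q
      s*p≡q = ℕM.m/n*n≡m p∣q

      s∣q : s ∣ q
      s∣q = divides p (P.trans (P.sym s*p≡q) (ℕP.*-comm s p))

      q∣s*s : q ∣ s ℕ.* s
      q∣s*s with ℕD.m*n∣o⇒m∣o/n p p p²∣q
      ... | divides k s≡kp = divides k (P.trans (P.cong (s ℕ.*_) s≡kp) (P.trans s[kp]≡k[sp] (P.cong (k ℕ.*_) s*p≡q)))
        where
        s[kp]≡k[sp] : s ℕ.* (k ℕ.* p) ≡ k ℕ.* (s ℕ.* p)
        s[kp]≡k[sp] = P.trans (P.sym (ℕP.*-assoc s k p)) (P.trans (P.cong (ℕ._* p) (ℕP.*-comm s k)) (ℕP.*-assoc k s p))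

      shift : ℕ → ℕ
      shift m = (m ℕ.+ s) % q

      shift≡ : ∀ m → + shift m ≡ + m mod s
      shift≡ m = mod-trans (mod-∣ s∣q (≡-%-shift q m s)) (congruent (+ 1) (P.cong (λ w → + m ℤ.+ w) (P.sym (ℤP.*-identityˡ (+ s)))))

      -- q and s = q/p have the same prime divisors
      coprime-q-shift : ∀ {x y} → x ≡ y mod s → Coprime q ∣ evalF F x ∣ → Coprime q ∣ evalF F y ∣
      coprime-q-shift {x} {y} x≡y q⊥Fx = coprime-∣ˡ q∣s*s (coprime-*ˡ s⊥Fy s⊥Fy)
        where
        s⊥Fy : Coprime s ∣ evalF F y ∣
        s⊥Fy = coprime-cong-mod (evalF-cong F x≡y) (coprime-∣ˡ s∣q q⊥Fx)

      𝟙X-shift : ∀ m → 𝟙 (X? q (shift m)) ≈ 𝟙 (X? q m)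
      𝟙X-shift m = 𝟙-⇔ (X? q (shift m)) (X? q m)
        (λ q⊥ → Coprime.coprime⇒gcd≡1 {q} {∣ evalF F (+ m) ∣} (coprime-q-shift (shift≡ m) (Coprime.gcd≡1⇒coprime q⊥)))
        (λ q⊥ → Coprime.coprime⇒gcd≡1 {q} {∣ evalF F (+ shift m) ∣} (coprime-q-shift (mod-sym (shift≡ m)) (Coprime.gcd≡1⇒coprime q⊥)))

      -- e_p(a)
      ω : ℕ → Carrier
      ω a = ζ^ (+ (N / q) ℤ.* (+ a ℤ.* + s))

      ζ^angle-shift : ∀ a m → ζ^ (angle q a (shift m)) ≈ ζ^ (angle q a m) * ω a
      ζ^angle-shift a m = begin
        ζ^ (+ (N / q) ℤ.* (+ a ℤ.* (+ shift m ℤ.- n)))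
          ≡⟨ ζ^-cong (mod-scale-cofactor q∣N (mod-*ˡ (+ a) (mod-+ (≡-%-shift q m s) (mod-refl (ℤ.- n))))) ⟩
        ζ^ (+ (N / q) ℤ.* (+ a ℤ.* ((+ m ℤ.+ + s) ℤ.- n)))
          ≡⟨ P.cong ζ^ (t[a[[m+s]-n]]≡t[a[m-n]]+t[as] (+ (N / q)) (+ a) (+ m) (+ s) n) ⟩
        ζ^ (angle q a m ℤ.+ + (N / q) ℤ.* (+ a ℤ.* + s))
          ≈⟨ ζ^-+ (angle q a m) (+ (N / q) ℤ.* (+ a ℤ.* + s)) ⟩
        ζ^ (angle q a m) * ω a ∎

      [N/q]*s≡N/p : (N / q) ℕ.* s ≡ N / p
      [N/q]*s≡N/p = P.sym (P.trans (P.cong (_/ p) N≡) (ℕM.m*n/n≡m ((N / q) ℕ.* s) p))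
        where
        N≡ : N ≡ (N / q) ℕ.* s ℕ.* p
        N≡ = P.sym (P.trans (ℕP.*-assoc (N / q) s p) (P.trans (P.cong ((N / q) ℕ.*_) s*p≡q) (ℕM.m/n*n≡m q∣N)))

      ω≉1 : ∀ a → gcd a q ≡ 1 → ω a ≉ 1#
      ω≉1 a a⊥q ω≈1 = prime≢1 p-prime (ℕD.∣1⇒≡1 (P.subst (p ∣_) a⊥q (gcd-greatest p∣a p∣q)))
        where
        [N/p]a≡0 : + (N / p) ℤ.* + a ≡ + 0 mod N
        [N/p]a≡0 = P.subst (_≡ + 0 mod N)
          (P.trans (t[aD]≡[tD]a (+ (N / q)) (+ a) (+ s)) (P.cong (ℤ._* + a) (P.trans (P.sym (ℤP.pos-* (N / q) s)) (P.cong +_ [N/q]*s≡N/p))))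
          (ζ^≈1⇒≡0 _ ω≈1)
        p∣a : p ∣ a
        p∣a = [n/p]*x≡0⇒p∣x (+ a) (ℕD.∣-trans p∣q q∣N) [N/p]a≡0

      expSum≈0 : ∀ a → gcd a q ≡ 1 → expSum q a ≈ 0#
      expSum≈0 a a⊥q = *-cancelˡ-≈0 (ω≉1 a a⊥q ∘ x-1≈0⇒x≈1) [ω-1]M≈0
        where
        w : ℕ → Carrier
        w m = 𝟙 (X? q m) * ζ^ (angle q a m)
        M≈M*ω : expSum q a ≈ expSum q a * ω a
        M≈M*ω = begin
          expSum q a                ≈⟨ ∑-↭ w (shift-%-↭ q s) ⟨
          ∑ w (map shift (upTo q))  ≡⟨ ∑-map w shift (upTo q) ⟩
          ∑ (w ∘ shift) (upTo q)    ≈⟨ ∑-cong (upTo q) (λ m → trans (*-cong (𝟙X-shift m) (ζ^angle-shift a m)) (sym (*-assoc _ _ _))) ⟩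
          ∑ (λ m → w m * ω a) (upTo q) ≈⟨ ∑-*ʳ (ω a) w (upTo q) ⟨
          expSum q a * ω a          ∎
        [ω-1]M≈0 : (ω a - 1#) * expSum q a ≈ 0#
        [ω-1]M≈0 = begin
          (ω a - 1#) * expSum q a            ≈⟨ trans (distribʳ _ _ _) (+-cong (*-comm _ _) (sym (-‿distribˡ-* 1# _))) ⟩
          expSum q a * ω a - 1# * expSum q a ≈⟨ +-cong (sym M≈M*ω) (-‿cong (*-identityˡ _)) ⟩
          expSum q a - expSum q a            ≈⟨ -‿inverseʳ _ ⟩
          0#                                 ∎

    αTerm-p² : αTerm q ≈ 0#
    αTerm-p² = trans (αTerm≈|X|⁻¹*doubleSum q q∣N) (trans (*-congˡ doubleSum≈0) (zeroʳ _))
      where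
      doubleSum≈0 : doubleSum q ≈ 0#
      doubleSum≈0 = trans (∑-cong (upTo q) term≈0) (∑-0 (upTo q))
        where
        term≈0 : ∀ a → 𝟙 (unit? q a) * expSum q a ≈ 0#
        term≈0 a with unit? q a
        ... | yes a⊥q = trans (*-congˡ (expSum≈0 a a⊥q)) (zeroʳ _)
        ... | no _ = zeroˡ _

  𝟙X1≈1 : 𝟙 (X? 1 0) ≈ 1#
  𝟙X1≈1 = 𝟙≈1 (X? 1 0) (Coprime.coprime⇒gcd≡1 {1} {∣ evalF F (+ 0) ∣} (ℕD.∣1⇒≡1 ∘ proj₁))

  |X|1≈1 : |X| 1 ≈ 1#
  |X|1≈1 = trans (|X|≈∑𝟙 1) (trans (+-identityʳ _) 𝟙X1≈1)

  αTerm-1 : αTerm 1 ≈ 1#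
  αTerm-1 = begin
    αTerm 1                   ≈⟨ αTerm≈|X|⁻¹*doubleSum 1 (ℕD.1∣ N) ⟩
    |X| 1 ⁻¹ * doubleSum 1    ≈⟨ *-cong (trans (⁻¹-cong (|X|≉0 1) |X|1≈1) 1#⁻¹≈1#) doubleSum1≈1 ⟩
    1# * 1#                   ≈⟨ *-identityˡ _ ⟩
    1#                        ∎
    where
    doubleSum1≈1 : doubleSum 1 ≈ 1#
    doubleSum1≈1 = begin
      𝟙 (unit? 1 0) * (𝟙 (X? 1 0) * ζ^ (angle 1 0 0) + 0#) + 0#  ≈⟨ +-identityʳ _ ⟩
      𝟙 (unit? 1 0) * (𝟙 (X? 1 0) * ζ^ (angle 1 0 0) + 0#)       ≈⟨ *-cong (𝟙≈1 (unit? 1 0) P.refl) (trans (+-identityʳ _) (*-cong 𝟙X1≈1 ζ^0≈1)) ⟩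
      1# * (1# * 1#)                                             ≈⟨ trans (*-identityˡ _) (*-identityˡ _) ⟩
      1#                                                         ∎
      where
      ζ^0≈1 : ζ^ (angle 1 0 0) ≈ 1#
      ζ^0≈1 = ζ^≈1 (P.subst (_≡ + 0 mod N) (P.sym (P.trans (P.cong (+ (N / 1) ℤ.*_) (ℤP.*-zeroˡ (+ 0 ℤ.- n))) (ℤP.*-zeroʳ (+ (N / 1))))) (mod-refl (+ 0)))

  γ : ℕ → Carrier
  γ = W.γ F

  h : ℕ → Carrier
  h = W.h F

  hᵖ : ℕ → Carrier
  hᵖ p = (1# - γ p) * γ p ⁻¹

  |Fn| : ℕ
  |Fn| = ∣ evalF F n ∣

  coprime? : (m d : ℕ) → Dec (gcd m d ≡ 1)
  coprime? m d = gcd m d ℕ.≟ 1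

  sieveWeight : ℕ → ℕ → Carrier
  sieveWeight d m = 𝟙 (d ∣? |Fn|) * (𝟙 (coprime? m d) * (fromℤ (μ d) * h m * γ d ⁻¹))

  sieveSummand : ℕ → ℕ → Carrier
  sieveSummand Q d = sieveWeight d (Q ÷ d)

  sieveTerm : ℕ → Carrier
  sieveTerm Q = ∑ (sieveSummand Q) (divisors Q)

  γ≉0 : ∀ d .{{_ : NonZero d}} → γ d ≉ 0#
  γ≉0 d = *-≉0 (|X|≉0 d) (⁻¹-≉0 (fromℕ≉0# d))

  γ-* : ∀ d e .{{_ : NonZero d}} .{{_ : NonZero e}} → Coprime d e → γ (d ℕ.* e) ≈ γ d * γ e
  γ-* d e d⊥e = begin
    |X| (d ℕ.* e) * fromℕ (d ℕ.* e) ⁻¹         ≈⟨ *-cong (|X|-crt d e d⊥e) (trans (⁻¹-cong (fromℕ≉0# (d ℕ.* e) {{ℕP.m*n≢0 d e}}) (fromℕ-* d e))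
                                                                              (⁻¹-* (fromℕ≉0# d) (fromℕ≉0# e))) ⟩
    (|X| d * |X| e) * (fromℕ d ⁻¹ * fromℕ e ⁻¹) ≈⟨ *-interchange _ _ _ _ ⟩
    γ d * γ e                                  ∎

  γ⁻¹-* : ∀ d e .{{_ : NonZero d}} .{{_ : NonZero e}} → Coprime d e → γ (d ℕ.* e) ⁻¹ ≈ γ d ⁻¹ * γ e ⁻¹
  γ⁻¹-* d e d⊥e = trans (⁻¹-cong (γ≉0 (d ℕ.* e) {{ℕP.m*n≢0 d e}}) (γ-* d e d⊥e)) (⁻¹-* (γ≉0 d) (γ≉0 e))

  γ⁻¹≈p/|X| : ∀ p .{{_ : NonZero p}} → γ p ⁻¹ ≈ fromℕ p * |X| p ⁻¹
  γ⁻¹≈p/|X| p = trans (⁻¹-* (|X|≉0 p) (⁻¹-≉0 (fromℕ≉0# p))) (trans (*-congˡ (⁻¹-involutive (fromℕ≉0# p))) (*-comm _ _))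

  hᵖ≈γ⁻¹-1 : ∀ p .{{_ : NonZero p}} → hᵖ p ≈ γ p ⁻¹ - 1#
  hᵖ≈γ⁻¹-1 p = trans (distribʳ _ _ _) (+-cong (*-identityˡ _) (trans (sym (-‿distribˡ-* _ _)) (-‿cong (inverse _ (γ≉0 p)))))

  γ1≈1 : γ 1 ≈ 1#
  γ1≈1 = begin
    |X| 1 * fromℕ 1 ⁻¹  ≈⟨ *-cong |X|1≈1 (⁻¹-cong (fromℕ≉0# 1) (+-identityʳ 1#)) ⟩
    1# * 1# ⁻¹          ≈⟨ *-identityˡ _ ⟩
    1# ⁻¹               ≈⟨ 1#⁻¹≈1# ⟩
    1#                  ∎

  h1≈1 : h 1 ≈ 1#
  h1≈1 = trans (*-identityʳ _) (trans (*-cong (+-identityʳ 1#) (+-identityʳ 1#)) (*-identityˡ 1#))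

  h-* : ∀ {p m} .{{_ : NonZero m}} → Prime p → ¬ p ∣ m → h (p ℕ.* m) ≈ hᵖ p * h m
  h-* {p} {m} p-prime p∤m = begin
    (fromℤ (μ (p ℕ.* m)) * fromℤ (μ (p ℕ.* m))) * W.prodK (map hᵖ (primeDivisors (p ℕ.* m)))
      ≈⟨ *-cong μ² (foldr-↭ (Perm.map⁺ hᵖ (primeDivisors-* p-prime p∤m))) ⟩
    (fromℤ (μ m) * fromℤ (μ m)) * (hᵖ p * W.prodK (map hᵖ (primeDivisors m)))
      ≈⟨ solve 3 (λ a b c → a :* (b :* c) := b :* (a :* c)) refl _ _ _ ⟩
    hᵖ p * h m ∎
    where
    μ² : fromℤ (μ (p ℕ.* m)) * fromℤ (μ (p ℕ.* m)) ≈ fromℤ (μ m) * fromℤ (μ m)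
    μ² = begin
      fromℤ (μ (p ℕ.* m)) * fromℤ (μ (p ℕ.* m))   ≡⟨ P.cong (λ z → fromℤ z * fromℤ z) (μ[p*m]≡-μ[m] p-prime p∤m) ⟩
      fromℤ (ℤ.- μ m) * fromℤ (ℤ.- μ m)           ≈⟨ *-cong (fromℤ-neg (μ m)) (fromℤ-neg (μ m)) ⟩
      - fromℤ (μ m) * - fromℤ (μ m)               ≈⟨ solve 1 (λ a → (:- a) :* (:- a) := a :* a) refl (fromℤ (μ m)) ⟩
      fromℤ (μ m) * fromℤ (μ m)                   ∎
    foldr-↭ : ∀ {xs ys : List Carrier} → xs ↭ ys → W.prodK xs ≈ W.prodK ys
    foldr-↭ xs↭ys = PermSetoid.foldr-commMonoid setoid *-isCommutativeMonoid (↭⇒↭ₛ′ isEquivalence xs↭ys)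

  h-p² : ∀ {p m} .{{_ : NonZero m}} → Prime p → p ℕ.* p ∣ m → h m ≈ 0#
  h-p² {p} {m} p-prime p²∣m = begin
    (fromℤ (μ m) * fromℤ (μ m)) * W.prodK (map hᵖ (primeDivisors m))
      ≡⟨ P.cong (λ z → (fromℤ z * fromℤ z) * W.prodK (map hᵖ (primeDivisors m))) (p*p∣q⇒μ≡0 p-prime p²∣m) ⟩
    (0# * 0#) * W.prodK (map hᵖ (primeDivisors m))                    ≈⟨ trans (*-congʳ (zeroˡ 0#)) (zeroˡ _) ⟩
    0#                                                                ∎

  αTerm-prime-hᵖ : ∀ p (p-prime : Prime p) → p ∣ N → αTerm p {{prime⇒nonZero p-prime}} ≈ hᵖ p - 𝟙 (p ∣? |Fn|) * γ p ⁻¹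
  αTerm-prime-hᵖ p p-prime p∣N = begin
    αTerm p                                          ≈⟨ αTerm-prime p p-prime p∣N ⟩
    𝟙 (X? p (n %ℕ p)) * (fromℕ p * |X| p ⁻¹) - 1#    ≈⟨ +-congʳ (*-cong (trans (𝟙-⇔ (X? p (n %ℕ p)) (¬? (p ∣? |Fn|)) to from) (𝟙-¬ (p ∣? |Fn|) (¬? (p ∣? |Fn|))))
                                                                          (sym (γ⁻¹≈p/|X| p))) ⟩
    (1# - i) * γ p ⁻¹ - 1#                           ≈⟨ +-congʳ (trans (distribʳ _ _ _) (+-congˡ (sym (-‿distribˡ-* _ _)))) ⟩
    (1# * γ p ⁻¹ - i * γ p ⁻¹) - 1#                  ≈⟨ +-congʳ (+-congʳ (*-identityˡ _)) ⟩
    (γ p ⁻¹ - i * γ p ⁻¹) - 1#                       ≈⟨ solve 3 (λ g x o → (g :- x) :- o := (g :- o) :- x) refl (γ p ⁻¹) (i * γ p ⁻¹) 1# ⟩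
    (γ p ⁻¹ - 1#) - i * γ p ⁻¹                       ≈⟨ +-congʳ (hᵖ≈γ⁻¹-1 p) ⟨
    hᵖ p - i * γ p ⁻¹                                ∎
    where
    instance _ = prime⇒nonZero p-prime
    i = 𝟙 (p ∣? |Fn|)
    r≡n : + (n %ℕ p) ≡ n mod p
    r≡n = mod-sym (≡-%ℕ n p)
    to : gcd p ∣ evalF F (+ (n %ℕ p)) ∣ ≡ 1 → ¬ p ∣ |Fn|
    to p⊥Fr p∣Fn = prime≢1 p-prime (Coprime.gcd≡1⇒coprime (X-cong (+ (n %ℕ p)) n r≡n p⊥Fr) (ℕD.∣-refl , p∣Fn))
    from : ¬ p ∣ |Fn| → gcd p ∣ evalF F (+ (n %ℕ p)) ∣ ≡ 1
    from p∤Fn = X-cong n (+ (n %ℕ p)) (mod-sym r≡n) (Coprime.coprime⇒gcd≡1 {p} {|Fn|} (prime-∤⇒coprime p-prime p∤Fn))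

  module _ {p q : ℕ} .{{_ : NonZero q}} (p-prime : Prime p) (p∤q : ¬ p ∣ q) where

    private
      instance
        p≢0 : NonZero p
        p≢0 = prime⇒nonZero p-prime

      p⊥ : ∀ {d} → d ∣ q → Coprime p d
      p⊥ d∣q = prime-∤⇒coprime p-prime (p∤q ∘ λ p∣d → ℕD.∣-trans p∣d d∣q)

      p∤q/d : ∀ {d} .{{_ : NonZero d}} → d ∣ q → ¬ p ∣ q ÷ d
      p∤q/d {d} d∣q p∣q/d = p∤q (ℕD.∣-trans (P.subst (p ∣_) (÷≡/ q d) p∣q/d) (ℕD.m/n∣m d∣q))

      q/d≢0 : ∀ {d} .{{_ : NonZero d}} → d ∣ q → NonZero (q ÷ d)
      q/d≢0 {d} d∣q = P.subst NonZero (P.sym (÷≡/ q d)) (n/d≢0 d∣q)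

      sieveSummand-*-coprime : ∀ {d} → d ∈ divisors q → sieveSummand (p ℕ.* q) d ≈ hᵖ p * sieveSummand q d
      sieveSummand-*-coprime {d} d∈ = begin
        𝟙 (d ∣? |Fn|) * (𝟙 (coprime? ((p ℕ.* q) ÷ d) d) * (fromℤ (μ d) * h ((p ℕ.* q) ÷ d) * γ d ⁻¹))
          ≡⟨ P.cong (λ z → 𝟙 (d ∣? |Fn|) * (𝟙 (coprime? z d) * (fromℤ (μ d) * h z * γ d ⁻¹))) pq/d≡p*q/d ⟩
        𝟙 (d ∣? |Fn|) * (𝟙 (coprime? (p ℕ.* m) d) * (fromℤ (μ d) * h (p ℕ.* m) * γ d ⁻¹))
          ≈⟨ *-congˡ (*-cong (𝟙-⇔ (coprime? (p ℕ.* m) d) (coprime? m d) to from) (*-congʳ (*-congˡ (h-* {{q/d≢0 d∣q}} p-prime (p∤q/d d∣q))))) ⟩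
        𝟙 (d ∣? |Fn|) * (𝟙 (coprime? m d) * (fromℤ (μ d) * (hᵖ p * h m) * γ d ⁻¹))
          ≈⟨ solve 6 (λ a b c f h g → a :* (b :* (c :* (f :* h) :* g)) := f :* (a :* (b :* (c :* h :* g)))) refl _ _ _ _ _ _ ⟩
        hᵖ p * sieveSummand q d ∎
        where
        instance _ = divisor≢0 d∈
        d∣q = ∈-divisors⁻ d∈
        m = q ÷ d
        pq/d≡p*q/d : (p ℕ.* q) ÷ d ≡ p ℕ.* m
        pq/d≡p*q/d = P.trans (÷≡/ (p ℕ.* q) d) (P.trans (ℕM.*-/-assoc p d∣q) (P.cong (p ℕ.*_) (P.sym (÷≡/ q d))))
        to : gcd (p ℕ.* m) d ≡ 1 → gcd m d ≡ 1
        to pm⊥d = Coprime.coprime⇒gcd≡1 {m} {d} (coprime-∣ˡ (ℕD.n∣m*n p) (Coprime.gcd≡1⇒coprime pm⊥d))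
        from : gcd m d ≡ 1 → gcd (p ℕ.* m) d ≡ 1
        from m⊥d = Coprime.coprime⇒gcd≡1 {p ℕ.* m} {d} (coprime-*ˡ (p⊥ d∣q) (Coprime.gcd≡1⇒coprime m⊥d))

      sieveSummand-*-p : ∀ {d} → d ∈ divisors q → sieveSummand (p ℕ.* q) (p ℕ.* d) ≈ - (𝟙 (p ∣? |Fn|) * γ p ⁻¹) * sieveSummand q d
      sieveSummand-*-p {d} d∈ = begin
        𝟙 (p ℕ.* d ∣? |Fn|) * (𝟙 (coprime? ((p ℕ.* q) ÷ (p ℕ.* d)) (p ℕ.* d)) * (fromℤ (μ (p ℕ.* d)) * h ((p ℕ.* q) ÷ (p ℕ.* d)) * γ (p ℕ.* d) ⁻¹))
          ≡⟨ P.cong (λ z → 𝟙 (p ℕ.* d ∣? |Fn|) * (𝟙 (coprime? z (p ℕ.* d)) * (fromℤ (μ (p ℕ.* d)) * h z * γ (p ℕ.* d) ⁻¹))) pq/pd≡q/d ⟩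
        𝟙 (p ℕ.* d ∣? |Fn|) * (𝟙 (coprime? m (p ℕ.* d)) * (fromℤ (μ (p ℕ.* d)) * h m * γ (p ℕ.* d) ⁻¹))
          ≈⟨ *-cong (trans (𝟙-⇔ (p ℕ.* d ∣? |Fn|) (p ∣? |Fn| ×-dec d ∣? |Fn|) split join) (𝟙-× (p ∣? |Fn|) (d ∣? |Fn|) (p ∣? |Fn| ×-dec d ∣? |Fn|)))
                    (*-cong (𝟙-⇔ (coprime? m (p ℕ.* d)) (coprime? m d) to from)
                            (*-cong (*-congʳ μ[pd]≈-μ[d]) (γ⁻¹-* p d (p⊥ d∣q)))) ⟩
        (𝟙 (p ∣? |Fn|) * 𝟙 (d ∣? |Fn|)) * (𝟙 (coprime? m d) * (- fromℤ (μ d) * h m * (γ p ⁻¹ * γ d ⁻¹)))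
          ≈⟨ solve 7 (λ a b c u h g v → (a :* b) :* (c :* (:- u :* h :* (g :* v))) := (:- (a :* g)) :* (b :* (c :* (u :* h :* v)))) refl _ _ _ _ _ _ _ ⟩
        - (𝟙 (p ∣? |Fn|) * γ p ⁻¹) * sieveSummand q d ∎
        where
        instance _ = divisor≢0 d∈
        instance _ = ℕP.m*n≢0 p d
        d∣q = ∈-divisors⁻ d∈
        m = q ÷ d
        pq/pd≡q/d : (p ℕ.* q) ÷ (p ℕ.* d) ≡ m
        pq/pd≡q/d = P.trans (÷≡/ (p ℕ.* q) (p ℕ.* d)) (P.trans (ℕM.m*n/m*o≡n/o p q d) (P.sym (÷≡/ q d)))
        μ[pd]≈-μ[d] : fromℤ (μ (p ℕ.* d)) ≈ - fromℤ (μ d)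
        μ[pd]≈-μ[d] = trans (reflexive (P.cong fromℤ (μ[p*m]≡-μ[m] p-prime (p∤q ∘ λ p∣d → ℕD.∣-trans p∣d d∣q)))) (fromℤ-neg (μ d))
        to : gcd m (p ℕ.* d) ≡ 1 → gcd m d ≡ 1
        to m⊥pd = Coprime.coprime⇒gcd≡1 {m} {d} (coprime-∣ʳ (ℕD.n∣m*n p) (Coprime.gcd≡1⇒coprime m⊥pd))
        from : gcd m d ≡ 1 → gcd m (p ℕ.* d) ≡ 1
        from m⊥d = Coprime.coprime⇒gcd≡1 {m} {p ℕ.* d}
          (coprime-*ʳ (Coprime.sym (prime-∤⇒coprime p-prime (p∤q/d d∣q))) (Coprime.gcd≡1⇒coprime m⊥d))
        split : p ℕ.* d ∣ |Fn| → (p ∣ |Fn|) × (d ∣ |Fn|)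
        split pd∣Fn = ℕD.m*n∣⇒m∣ p d pd∣Fn , ℕD.m*n∣⇒n∣ p d pd∣Fn
        join : (p ∣ |Fn|) × (d ∣ |Fn|) → p ℕ.* d ∣ |Fn|
        join (p∣Fn , d∣Fn) = coprime-∣-* (p⊥ d∣q) p∣Fn d∣Fn

    sieveTerm-* : sieveTerm (p ℕ.* q) ≈ (hᵖ p - 𝟙 (p ∣? |Fn|) * γ p ⁻¹) * sieveTerm q
    sieveTerm-* = begin
      ∑ (sieveSummand (p ℕ.* q)) (divisors (p ℕ.* q))                                ≈⟨ ∑-↭ (sieveSummand (p ℕ.* q)) (divisors-* p-prime p∤q) ⟩
      ∑ (sieveSummand (p ℕ.* q)) (divisors q ++ map (p ℕ.*_) (divisors q))           ≈⟨ ∑-++ (sieveSummand (p ℕ.* q)) (divisors q) _ ⟩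
      ∑ (sieveSummand (p ℕ.* q)) (divisors q) + ∑ (sieveSummand (p ℕ.* q)) (map (p ℕ.*_) (divisors q))
        ≡⟨ P.cong (λ w → ∑ (sieveSummand (p ℕ.* q)) (divisors q) + w) (∑-map (sieveSummand (p ℕ.* q)) (p ℕ.*_) (divisors q)) ⟩
      ∑ (sieveSummand (p ℕ.* q)) (divisors q) + ∑ (λ d → sieveSummand (p ℕ.* q) (p ℕ.* d)) (divisors q)
        ≈⟨ +-cong (∑-cong-∈ (divisors q) sieveSummand-*-coprime) (∑-cong-∈ (divisors q) sieveSummand-*-p) ⟩
      ∑ (λ d → hᵖ p * sieveSummand q d) (divisors q) + ∑ (λ d → - (𝟙 (p ∣? |Fn|) * γ p ⁻¹) * sieveSummand q d) (divisors q)
        ≈⟨ +-cong (∑-*ˡ _ _ (divisors q)) (∑-*ˡ _ _ (divisors q)) ⟨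
      hᵖ p * sieveTerm q + - (𝟙 (p ∣? |Fn|) * γ p ⁻¹) * sieveTerm q                   ≈⟨ distribʳ _ _ _ ⟨
      (hᵖ p - 𝟙 (p ∣? |Fn|) * γ p ⁻¹) * sieveTerm q                                  ∎

  -- If (Q/d, d) = 1 and p² ∣ Q then p² divides d or Q/d, killing μ(d) or h(Q/d).
  sieveTerm-p² : ∀ {p Q} .{{_ : NonZero Q}} → Prime p → p ℕ.* p ∣ Q → sieveTerm Q ≈ 0#
  sieveTerm-p² {p} {Q} p-prime p²∣Q = trans (∑-cong-∈ (divisors Q) summand≈0) (∑-0 (divisors Q))
    where
    summand≈0 : ∀ {d} → d ∈ divisors Q → sieveSummand Q d ≈ 0#
    summand≈0 {d} d∈ with coprime? (Q ÷ d) d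
    ... | no _ = trans (*-congˡ (zeroˡ _)) (zeroʳ _)
    ... | yes m⊥d = trans (*-congˡ (trans (*-identityˡ _) μh≈0)) (zeroʳ _)
      where
      instance _ = divisor≢0 d∈
      m = Q / d
      instance
        m≢0 : NonZero m
        m≢0 = n/d≢0 (∈-divisors⁻ d∈)
      Q≡dm : Q ≡ d ℕ.* m
      Q≡dm = P.sym (ℕM.m*[n/m]≡n (∈-divisors⁻ d∈))
      m⊥d′ : Coprime m d
      m⊥d′ = P.subst (λ z → Coprime z d) (÷≡/ Q d) (Coprime.gcd≡1⇒coprime m⊥d)
      p²∣ : ∀ {a b} → Coprime a b → Q ≡ a ℕ.* b → p ∣ a → p ℕ.* p ∣ a
      p²∣ {a} {b} a⊥b Q≡ab p∣a = Coprime.coprime-divisor (coprime-*ˡ p⊥b p⊥b) (P.subst (p ℕ.* p ∣_) (P.trans Q≡ab (ℕP.*-comm a b)) p²∣Q)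
        where
        p⊥b : Coprime p b
        p⊥b = prime-∤⇒coprime p-prime (λ p∣b → prime≢1 p-prime (a⊥b (p∣a , p∣b)))
      μh≈0 : fromℤ (μ d) * h (Q ÷ d) * γ d ⁻¹ ≈ 0#
      μh≈0 with euclidsLemma d m p-prime (P.subst (p ∣_) Q≡dm (ℕD.∣-trans (ℕD.m∣m*n p) p²∣Q))
      ... | inj₁ p∣d = trans (*-congʳ (trans (*-congʳ (reflexive (P.cong fromℤ (p*p∣q⇒μ≡0 p-prime (p²∣ (Coprime.sym m⊥d′) Q≡dm p∣d))))) (zeroˡ _))) (zeroˡ _)
      ... | inj₂ p∣m = trans (*-congʳ (trans (*-congˡ h≈0) (zeroʳ _))) (zeroˡ _)
        where
        h≈0 : h (Q ÷ d) ≈ 0#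
        h≈0 = trans (reflexive (P.cong h (÷≡/ Q d))) (h-p² p-prime (p²∣ m⊥d′ (P.trans Q≡dm (ℕP.*-comm d m)) p∣m))

  sieveTerm-1 : sieveTerm 1 ≈ 1#
  sieveTerm-1 = begin
    sieveSummand 1 1 + 0#                                             ≈⟨ +-identityʳ _ ⟩
    𝟙 (1 ∣? |Fn|) * (𝟙 (coprime? 1 1) * (fromℤ (+ 1) * h 1 * γ 1 ⁻¹))
      ≈⟨ *-cong (𝟙≈1 (1 ∣? |Fn|) (ℕD.1∣ |Fn|)) (*-cong (𝟙≈1 (coprime? 1 1) P.refl) μhγ⁻¹≈1) ⟩
    1# * (1# * 1#)                                                    ≈⟨ trans (*-identityˡ _) (*-identityˡ _) ⟩
    1#                                                                ∎
    where
    μhγ⁻¹≈1 : fromℤ (+ 1) * h 1 * γ 1 ⁻¹ ≈ 1#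
    μhγ⁻¹≈1 = trans (*-cong (*-cong (+-identityʳ 1#) h1≈1) (trans (⁻¹-cong (γ≉0 1) γ1≈1) 1#⁻¹≈1#))
                    (trans (*-identityʳ _) (*-identityˡ _))

  αTerm≈sieveTerm : ∀ q .{{_ : NonZero q}} → q ∣ N → αTerm q ≈ sieveTerm q
  αTerm≈sieveTerm q {{q≢0}} = <-rec Claim step q q≢0
    where
    Claim : ℕ → Set
    Claim q = .(q≢0 : NonZero q) → q ∣ N → αTerm q {{q≢0}} ≈ sieveTerm q
    step : ∀ q → (∀ {q′} → q′ ℕ.< q → Claim q′) → Claim q
    step (suc zero) _ _ _ = trans αTerm-1 (sym sieveTerm-1)
    step (suc (suc k)) ih _ q∣N with prime-factor k
    ... | p , p-prime , p∣q = P.subst Claim pq′≡q step-pq′ _ q∣N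
      where
      instance _ = prime⇒nonZero p-prime
      q′ = suc (suc k) / p
      instance
        q′≢0 : NonZero q′
        q′≢0 = n/d≢0 p∣q
      pq′≡q : p ℕ.* q′ ≡ suc (suc k)
      pq′≡q = ℕM.m*[n/m]≡n p∣q
      step-pq′ : Claim (p ℕ.* q′)
      step-pq′ pq′≢0 pq′∣N with p ∣? q′
      ... | yes p∣q′ = trans (αTerm-p² (p ℕ.* q′) p {{pq′≢0}} p-prime p²∣pq′ pq′∣N) (sym (sieveTerm-p² {{pq′≢0}} p-prime p²∣pq′))
        where p²∣pq′ = ℕD.*-monoʳ-∣ p p∣q′
      ... | no p∤q′ = begin
        αTerm (p ℕ.* q′) {{pq′≢0}}                     ≈⟨ αTerm-* p q′ (prime-∤⇒coprime p-prime p∤q′) pq′∣N ⟩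
        αTerm p * αTerm q′                             ≈⟨ *-cong (αTerm-prime-hᵖ p p-prime p∣N) (ih q′<q q′≢0 q′∣N) ⟩
        (hᵖ p - 𝟙 (p ∣? |Fn|) * γ p ⁻¹) * sieveTerm q′  ≈⟨ sieveTerm-* p-prime p∤q′ ⟨
        sieveTerm (p ℕ.* q′)                           ∎
        where
        p∣N = ℕD.∣-trans (ℕD.m∣m*n q′) pq′∣N
        q′∣N = ℕD.∣-trans (ℕD.n∣m*n p) pq′∣N
        q′<q : q′ ℕ.< suc (suc k)
        q′<q = ℕM.m/n<m (suc (suc k)) p (prime⇒>1 p-prime)

  -- Positivity of h, and G(R) ≠ 0

  -- h(p) = (p - |X_p|) / |X_p| with 0 < |X_p| ≤ p
  hᵖ-nonNegative : ∀ p .{{_ : NonZero p}} → NonNegative (hᵖ p)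
  hᵖ-nonNegative p = p ℕ.∸ suc b , b , (begin
    hᵖ p * fromℕ (suc b)                      ≈⟨ *-cong (trans (hᵖ≈γ⁻¹-1 p) (+-congʳ (γ⁻¹≈p/|X| p))) (sym |X|≈1+b) ⟩
    (fromℕ p * |X| p ⁻¹ - 1#) * |X| p         ≈⟨ trans (distribʳ _ _ _) (+-cong p/|X|*|X|≈p (trans (sym (-‿distribˡ-* _ _)) (-‿cong (*-identityˡ _)))) ⟩
    fromℕ p - |X| p                           ≈⟨ +-congˡ (-‿cong |X|≈1+b) ⟩
    fromℕ p - fromℕ (suc b)                   ≈⟨ fromℕ-∸ 1+b≤p ⟨
    fromℕ (p ℕ.∸ suc b)                       ∎)
    where
    b = ℕ.pred (cardX F p)
    |X|≡ : suc b ≡ cardX F p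
    |X|≡ = ℕP.suc-pred (cardX F p) {{ℕ.>-nonZero (|X|>0 p (ℕ.>-nonZero⁻¹ p))}}
    |X|≈1+b : |X| p ≈ fromℕ (suc b)
    |X|≈1+b = reflexive (P.cong fromℕ (P.sym |X|≡))
    p/|X|*|X|≈p : fromℕ p * |X| p ⁻¹ * |X| p ≈ fromℕ p
    p/|X|*|X|≈p = trans (*-assoc _ _ _) (trans (*-congˡ (inverseˡ (|X|≉0 p))) (*-identityʳ _))
    1+b≤p : suc b ℕ.≤ p
    1+b≤p = P.subst (ℕ._≤ p) (P.sym |X|≡) (P.subst (cardX F p ℕ.≤_) (List.length-upTo p) (List.length-filter (X? p) (upTo p)))

  h-nonNegative : ∀ q → NonNegative (h q)
  h-nonNegative q = nonNegative-* μ²-nonNegative (∏-nonNegative (primeDivisors q) (λ {p} p∈ → hᵖ-nonNegative p {{prime⇒nonZero (proj₁ (∈-primeDivisors⁻ {q} p∈))}}))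
    where
    μ²-nonNegative : NonNegative (fromℤ (μ q) * fromℤ (μ q))
    μ²-nonNegative with μ≡0⊎μ²≡1 q
    ... | inj₁ μ≡0 rewrite μ≡0 = nonNegative-cong (sym (zeroˡ _)) nonNegative-0
    ... | inj₂ μ²≡1 = 1 , 0 , trans (*-congˡ (+-identityʳ 1#)) (trans (*-identityʳ _) (trans (sym (fromℤ-* (μ q) (μ q))) (reflexive (P.cong fromℤ μ²≡1))))
    ∏-nonNegative : ∀ ps → (∀ {p} → p ∈ ps → NonNegative (hᵖ p)) → NonNegative (W.prodK (map hᵖ ps))
    ∏-nonNegative [] _ = 1 , 0 , *-identityˡ _
    ∏-nonNegative (p ∷ ps) nonNeg = nonNegative-* (nonNeg (here P.refl)) (∏-nonNegative ps (nonNeg ∘ there))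

  G≉0 : ∀ R → 1 ℕ.≤ R → W.G F R ≉ 0#
  G≉0 (suc R) _ = positive⇒≉0 (positive-cong (sym (∑-upTo-suc-shift (λ i → h (suc i)) R))
    (positive-+ (positive-cong (sym h1≈1) positive-1) (∑-nonNegative (upTo R))))
    where
    ∑-nonNegative : ∀ is → NonNegative (∑ (λ i → h (suc (suc i))) is)
    ∑-nonNegative [] = nonNegative-0
    ∑-nonNegative (i ∷ is) = nonNegative-+ (h-nonNegative (suc (suc i))) (∑-nonNegative is)

  -- The right-hand side as ∑_{q ≤ R} sieveTerm q

  G*𝟙*λ≈∑sieveWeight : ∀ R → W.G F R ≉ 0# → ∀ d .{{_ : NonZero d}} →
    W.G F R * (𝟙 (d ∣? |Fn|) * W.λ' F R d) ≈ ∑ (sieveWeight d ∘ suc) (upTo (R / d))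
  G*𝟙*λ≈∑sieveWeight R G≉0 d = begin
    G * (i * ((m * Gd) * (γ d * G) ⁻¹))    ≈⟨ *-congˡ (*-congˡ (*-congˡ (⁻¹-* (γ≉0 d) G≉0))) ⟩
    G * (i * ((m * Gd) * (γ d ⁻¹ * G ⁻¹)))
      ≈⟨ solve 6 (λ g i m s c h → g :* (i :* ((m :* s) :* (c :* h))) := (i :* (m :* s :* c)) :* (g :* h)) refl G i m Gd (γ d ⁻¹) (G ⁻¹) ⟩
    (i * (m * Gd * γ d ⁻¹)) * (G * G ⁻¹)   ≈⟨ trans (*-congˡ (inverse _ G≉0)) (*-identityʳ _) ⟩
    i * (m * Gd * γ d ⁻¹)                  ≈⟨ *-congˡ (*-congʳ (*-congˡ (∑-filter (λ j → coprime? (suc j) d) (h ∘ suc) (upTo (R / d))))) ⟩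
    i * (m * ∑ (λ j → 𝟙 (coprime? (suc j) d) * h (suc j)) (upTo (R / d)) * γ d ⁻¹)
      ≈⟨ *-congˡ (trans (*-congʳ (∑-*ˡ m _ (upTo (R / d)))) (∑-*ʳ (γ d ⁻¹) _ (upTo (R / d)))) ⟩
    i * ∑ (λ j → m * (𝟙 (coprime? (suc j) d) * h (suc j)) * γ d ⁻¹) (upTo (R / d)) ≈⟨ ∑-*ˡ i _ (upTo (R / d)) ⟩
    ∑ (λ j → i * (m * (𝟙 (coprime? (suc j) d) * h (suc j)) * γ d ⁻¹)) (upTo (R / d))
      ≈⟨ ∑-cong (upTo (R / d)) (λ j → solve 5 (λ i m c h g → i :* (m :* (c :* h) :* g) := i :* (c :* (m :* h :* g))) refl i m _ _ _) ⟩
    ∑ (sieveWeight d ∘ suc) (upTo (R / d)) ∎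
    where
    G = W.G F R
    i = 𝟙 (d ∣? |Fn|)
    m = fromℤ (μ d)
    Gd = W.Gd F d (R / d)

  sieveTerm≈∑upTo : ∀ k R → suc k ℕ.≤ R →
    sieveTerm (suc k) ≈ ∑ (λ i → 𝟙 (suc i ∣? suc k) * sieveWeight (suc i) (suc k / suc i)) (upTo R)
  sieveTerm≈∑upTo k R 1+k≤R = begin
    ∑ (sieveSummand Q) (divisors Q)                          ≈⟨ ∑-filter (_∣? Q) (sieveSummand Q) (upTo (suc Q)) ⟩
    ∑ (λ d → 𝟙 (d ∣? Q) * sieveSummand Q d) (upTo (suc Q))   ≈⟨ ∑-upTo-suc-shift (λ d → 𝟙 (d ∣? Q) * sieveSummand Q d) Q ⟩
    𝟙 (0 ∣? Q) * sieveSummand Q 0 + ∑ f (upTo Q)             ≈⟨ trans (+-congʳ (trans (*-congʳ (𝟙≈0 (0 ∣? Q) (ℕP.1+n≢0 ∘ ℕD.0∣⇒≡0))) (zeroˡ _))) (+-identityˡ _) ⟩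
    ∑ f (upTo Q)                                             ≈⟨ ∑-upTo-vanishing f Q f≈0 1+k≤R ⟨
    ∑ f (upTo R)                                             ∎
    where
    Q = suc k
    f = λ i → 𝟙 (suc i ∣? Q) * sieveWeight (suc i) (Q / suc i)
    f≈0 : ∀ i → Q ℕ.≤ i → f i ≈ 0#
    f≈0 i Q≤i = trans (*-congʳ (𝟙≈0 (suc i ∣? Q) (λ 1+i∣Q → ℕP.<-irrefl P.refl (ℕP.≤-trans (ℕ.s≤s Q≤i) (ℕD.∣⇒≤ 1+i∣Q))))) (zeroˡ _)

  rhs≈∑sieveTerm : ∀ R → 1 ℕ.≤ R → W.rhs F R n ≈ ∑ (sieveTerm ∘ suc) (upTo R)
  rhs≈∑sieveTerm R 1≤R = begin
    G * ∑ (λ i → W.λ' F R (suc i)) (filter (λ i → suc i ∣? |Fn|) (upTo R))           ≈⟨ *-congˡ (∑-filter (λ i → suc i ∣? |Fn|) _ (upTo R)) ⟩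
    G * ∑ (λ i → 𝟙 (suc i ∣? |Fn|) * W.λ' F R (suc i)) (upTo R)                      ≈⟨ ∑-*ˡ G _ (upTo R) ⟩
    ∑ (λ i → G * (𝟙 (suc i ∣? |Fn|) * W.λ' F R (suc i))) (upTo R)                    ≈⟨ ∑-cong (upTo R) (λ i → G*𝟙*λ≈∑sieveWeight R (G≉0 R 1≤R) (suc i)) ⟩
    ∑ (λ i → ∑ (sieveWeight (suc i) ∘ suc) (upTo (R / suc i))) (upTo R)               ≈⟨ ∑-cong (upTo R) (λ i → ∑-multiples (suc i) (sieveWeight (suc i)) R) ⟨
    ∑ (λ i → ∑ (λ k → 𝟙 (suc i ∣? suc k) * sieveWeight (suc i) (suc k / suc i)) (upTo R)) (upTo R) ≈⟨ ∑-comm _ (upTo R) (upTo R) ⟩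
    ∑ (λ k → ∑ (λ i → 𝟙 (suc i ∣? suc k) * sieveWeight (suc i) (suc k / suc i)) (upTo R)) (upTo R) ≈⟨ ∑-upTo-cong R (λ k k<R → sieveTerm≈∑upTo k R k<R) ⟨
    ∑ (sieveTerm ∘ suc) (upTo R)                                                     ∎
    where
    G = W.G F R

lemma7p8 : (F : LinFactors) → All (λ ab → proj₁ ab ≢ + 0) F → disc F ≢ + 0
    → (∀ q → 1 ≤ q → 0 < cardX F q)
    → (R : ℕ) → 1 ≤ R
    → (N : ℕ) → 1 ≤ N → (∀ q → 1 ≤ q → q ≤ R → q ∣ N)
    → (C : CycloField N) → (n : ℤ)
    → CycloField._≈_ C (WithField.α C F R n) (WithField.rhs C F R n)
lemma7p8 F _ _ |X|>0 R 1≤R N 1≤N q≤R⇒q∣N C n = begin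
  α F R n                         ≈⟨ ∑-upTo-cong R (λ i i<R → αTerm≈sieveTerm (suc i) (q≤R⇒q∣N (suc i) (ℕ.s≤s ℕ.z≤n) i<R)) ⟩
  ∑ (sieveTerm ∘ suc) (upTo R)    ≈⟨ rhs≈∑sieveTerm R 1≤R ⟨
  rhs F R n                       ∎
  where
  instance _ = ℕ.>-nonZero 1≤N
  open CycloField C using (K; setoid)
  open RingProperties K using (∑; ∑-upTo-cong)
  open Expansion C F n |X|>0 using (αTerm≈sieveTerm; sieveTerm; rhs≈∑sieveTerm)
  open WithField C using (α; rhs)
  open import Relation.Binary.Reasoning.Setoid setoid
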